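{- Let $\lambda$ be a strict partition and let $n$ be a positive integer such that $\mathrm{SSVT}_P(\lambda,n)\neq\emptyset$ and $\mathrm{SSVT}_Q(\lambda,n)\neq\emptyset$. Then, as Laurent polynomials in $\beta$, $$GP_{\lambda}(\beta,\dots,\beta \mid -\beta^{ -1})=\beta^{|\lambda|},\qquad GQ_{\lambda}(\beta,\dots,\beta \mid -\beta^{ -1})=\beta^{|\lambda|},$$ where all $n$ variables $x_1,\dots,x_n$ are specialized to $\beta$ and the parameter is specialized to $-\beta^{ -1}$.
   Context: A strict partition is $\lambda=(\lambda_1>\lambda_2>\dots>\lambda_r>0)$; $\ell(\lambda)=r$, $|\lambda|=\sum_i\lambda_i$. Its shifted Young diagram is $\mathrm{SYD}_\lambda=\{(i,j): 1\le i\le \ell(\lambda),\ i\le j\le \lambda_i+i-1\}$ (row index $i$, column index $j$); boxes $(i,i)$ are the diagonal boxes. For $k\in[n]=\{1,\dots,n\}$ put $k'=k-\tfrac12$, and let $[n',n]=\{1'<1<2'<2<\dots<n'<n\}$. A shifted set-valued tableau of shape $\lambda$ with $n$ variables is a map $T$ assigning to each box $(i,j)\in\mathrm{SYD}_\lambda$ a nonempty subset $T_{i,j}\subseteq[n',n]$ such that: (1) $\max T_{i,j}\le \min T_{i,j+1}$ and $\max T_{i,j}\le\min T_{i+1,j}$ whenever the boxes exist; (2) each unprimed $k\in[n]$ appears at most once in each column; (3) each primed $k'$ appears at most once in each row; (4) $T_{i,i}\subseteq[n]$ for diagonal boxes. $\mathrm{SSVT}_P(\lambda,n)$ is the set of such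 tableaux, and $\mathrm{SSVT}_Q(\lambda,n)$ is the set of maps satisfying (1)–(3) but not necessarily (4). For such $T$, $|T|$ is the total number of entries (sum of the sizes of all $T_{i,j}$), $\omega_k(T)$ is the number of occurrences of $k$ or $k'$ in $T$, and $x^{\omega(T)}=\prod_{k=1}^n x_k^{\omega_k(T)}$. Define $GP_\lambda(x\mid\beta)=\sum_{T\in\mathrm{SSVT}_P(\lambda,n)}\beta^{|T|-|\lambda|}x^{\omega(T)}$ and $GQ_\lambda(x\mid\beta)=\sum_{T\in\mathrm{SSVT}_Q(\lambda,n)}\beta^{|T|-|\lambda|}x^{\omega(T)}$. -}

module Defs where

open import Data.Nat as ℕ using (ℕ; zero; suc; _+_; _∸_; _≤_; _<_; _%_; ⌈_/2⌉; _≤?_)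
import Data.Nat.Properties as ℕP
open import Data.Integer as ℤ using (ℤ; +_; -[1+_])
open import Data.List using (List; []; _∷_; _++_; map; concatMap; concat; foldr; length; filter; applyUpTo)
open import Data.Nat.ListAction using (sum)
open import Data.List.Relation.Unary.All using (All; all?)
open import Data.List.Relation.Unary.Linked using (Linked)
open import Data.List.Membership.Propositional using (_∉_)
open import Data.List.Membership.DecPropositional ℕP._≟_ using (_∉?_)
open import Data.Product using (_×_; _,_; proj₁; proj₂)
open import Data.Product.Properties using (≡-dec)
open import Relation.Binary.PropositionalEquality using (_≡_; _≢_)
open import Relation.Nullary using (Dec; yes; no; ¬?; _×-dec_; _→-dec_)
open import Relation.Unary using (Decidable)

StrictPartition : List ℕ → Set
StrictPartition lam = Linked (λ a b → b < a) lam × All (λ a → 0 < a) lam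

size : List ℕ → ℕ
size = sum

-- Shifted Young diagram: boxes (i , j), 1-indexed, i ≤ j ≤ λ_i + i - 1.

Box : Set
Box = ℕ × ℕ

row col : Box → ℕ
row = proj₁
col = proj₂

_≟B_ : (b c : Box) → Dec (b ≡ c)
_≟B_ = ≡-dec ℕP._≟_ ℕP._≟_

boxesFrom : ℕ → List ℕ → List Box
boxesFrom i []         = []
boxesFrom i (a ∷ rest) = applyUpTo (λ t → (i , i + t)) a ++ boxesFrom (suc i) rest

SYD : List ℕ → List Box
SYD = boxesFrom 1

-- The alphabet [n', n] = {1' < 1 < … < n' < n}.
-- An element v ∈ [n', n] is encoded by the natural number 2v, i.e.
-- k' = k - 1/2 ↦ 2k - 1 and k ↦ 2k.  The encoding is order preserving.

letters : ℕ → List ℕ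
letters n = applyUpTo suc (2 ℕ.* n)

Unprimed Primed : ℕ → Set
Unprimed c = c % 2 ≡ 0
Primed   c = c % 2 ≡ 1

-- the k such that the code is k or k'
index : ℕ → ℕ
index c = ⌈ c /2⌉

-- subsets of a list (order preserving, so subsets come as increasing lists)
subsets : {A : Set} → List A → List (List A)
subsets []       = [] ∷ []
subsets (x ∷ xs) = map (x ∷_) (subsets xs) ++ subsets xs

nonemptySubsets : {A : Set} → List A → List (List A)
nonemptySubsets []       = []
nonemptySubsets (x ∷ xs) = map (x ∷_) (subsets xs) ++ nonemptySubsets xs

-- Fillings: a filling of a list of m boxes assigns (positionally) a
-- nonempty subset of [n', n] to each box.  `fillings n m` enumerates
-- every such assignment exactly once.

Filling : Set
Filling = List (List ℕ)

fillings : ℕ → ℕ → List Filling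
fillings n zero    = [] ∷ []
fillings n (suc m) = concatMap (λ s → map (s ∷_) (fillings n m)) (nonemptySubsets (letters n))

-- the entry T_{b} of box b (empty if b is not a box of the diagram)
at : List Box → Filling → Box → List ℕ
at (b ∷ bs) (s ∷ ss) c with b ≟B c
... | yes _ = s
... | no  _ = at bs ss c
at _ _ c = []

-- max s ≤ min t  (for nonempty s, t); vacuous if one of them is empty
_≼_ : List ℕ → List ℕ → Set
s ≼ t = All (λ a → All (λ b → a ≤ b) t) s

_≼?_ : (s t : List ℕ) → Dec (s ≼ t)
s ≼? t = all? (λ a → all? (λ b → a ≤? b) t) s

module _ (lam : List ℕ) (T : Filling) where
  private
    B = SYD lam
    E = at B T

  Cond1 : Set
  Cond1 = All (λ b → (E b ≼ E (row b , suc (col b))) × (E b ≼ E (suc (row b) , col b))) B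

  Cond2 : Set
  Cond2 = All (λ b₁ → All (λ b₂ → b₁ ≢ b₂ → col b₁ ≡ col b₂ →
            All (λ c → Unprimed c → c ∉ E b₂) (E b₁)) B) B

  Cond3 : Set
  Cond3 = All (λ b₁ → All (λ b₂ → b₁ ≢ b₂ → row b₁ ≡ row b₂ →
            All (λ c → Primed c → c ∉ E b₂) (E b₁)) B) B

  Cond4 : Set
  Cond4 = All (λ b → row b ≡ col b → All Unprimed (E b)) B

  cond1? : Dec Cond1
  cond1? = all? (λ b → (E b ≼? E (row b , suc (col b))) ×-dec (E b ≼? E (suc (row b) , col b))) B

  cond2? : Dec Cond2
  cond2? = all? (λ b₁ → all? (λ b₂ → ¬? (b₁ ≟B b₂) →-dec (ℕP._≟_ (col b₁) (col b₂) →-dec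
             all? (λ c → ℕP._≟_ (c % 2) 0 →-dec (c ∉? E b₂)) (E b₁))) B) B

  cond3? : Dec Cond3
  cond3? = all? (λ b₁ → all? (λ b₂ → ¬? (b₁ ≟B b₂) →-dec (ℕP._≟_ (row b₁) (row b₂) →-dec
             all? (λ c → ℕP._≟_ (c % 2) 1 →-dec (c ∉? E b₂)) (E b₁))) B) B

  cond4? : Dec Cond4
  cond4? = all? (λ b → ℕP._≟_ (row b) (col b) →-dec all? (λ c → ℕP._≟_ (c % 2) 0) (E b)) B

IsSSVT-Q : List ℕ → Filling → Set
IsSSVT-Q lam T = Cond1 lam T × Cond2 lam T × Cond3 lam T

IsSSVT-P : List ℕ → Filling → Set
IsSSVT-P lam T = IsSSVT-Q lam T × Cond4 lam T

isSSVT-Q? : (lam : List ℕ) → Decidable (IsSSVT-Q lam)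
isSSVT-Q? lam T = cond1? lam T ×-dec cond2? lam T ×-dec cond3? lam T

isSSVT-P? : (lam : List ℕ) → Decidable (IsSSVT-P lam)
isSSVT-P? lam T = isSSVT-Q? lam T ×-dec cond4? lam T

SSVT-P : List ℕ → ℕ → List Filling
SSVT-P lam n = filter (isSSVT-P? lam) (fillings n (length (SYD lam)))

SSVT-Q : List ℕ → ℕ → List Filling
SSVT-Q lam n = filter (isSSVT-Q? lam) (fillings n (length (SYD lam)))

card : Filling → ℕ
card T = sum (map length T)

ω : ℕ → Filling → ℕ
ω k T = length (filter (λ c → ℕP._≟_ (index c) k) (concat T))

-- Laurent polynomials in β with integer coefficients, as formal sums of
-- terms (coefficient , exponent); equality is equality of all coefficients.

LPoly : Set
LPoly = List (ℤ × ℤ)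

_+L_ : LPoly → LPoly → LPoly
_+L_ = _++_

_*L_ : LPoly → LPoly → LPoly
p *L q = concatMap (λ t → map (λ u → (proj₁ t ℤ.* proj₁ u , proj₂ t ℤ.+ proj₂ u)) q) p

oneL : LPoly
oneL = (+ 1 , + 0) ∷ []

_^L_ : LPoly → ℕ → LPoly
p ^L zero  = oneL
p ^L suc m = p *L (p ^L m)

βL : LPoly
βL = (+ 1 , + 1) ∷ []

-βinv : LPoly
-βinv = (-[1+ 0 ] , -[1+ 0 ]) ∷ []

coeff : LPoly → ℤ → ℤ
coeff []            e = + 0
coeff ((c , f) ∷ p) e with ℤ._≟_ f e
... | yes _ = c ℤ.+ coeff p e
... | no  _ = coeff p e

_≈L_ : LPoly → LPoly → Set
p ≈L q = ∀ e → coeff p e ≡ coeff q e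

evalG : List ℕ → ℕ → List Filling → (ℕ → LPoly) → LPoly → LPoly
evalG lam n Ts x b = concatMap (λ T → (b ^L (card T ∸ size lam)) *L
    foldr _*L_ oneL (map (λ k → x k ^L ω k T) (applyUpTo suc n))) Ts

GP : List ℕ → ℕ → (ℕ → LPoly) → LPoly → LPoly
GP lam n = evalG lam n (SSVT-P lam n)

GQ : List ℕ → ℕ → (ℕ → LPoly) → LPoly → LPoly
GQ lam n = evalG lam n (SSVT-Q lam n)

{-# OPTIONS --safe #-}
-- At x = β and b = −β⁻¹ a tableau T contributes (−1)^(|T|−|λ|) β^|λ|, so both identities say that the
-- signed count of set-valued tableaux is 1. Split every entry into its minimum and the set of its
-- other letters. A filling is a tableau iff the minima form a single-valued tableau S and every other
-- letter is admissible for S in its box, i.e. compatible with the minima of the right and lower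
-- neighbours. For fixed S the signed sum over the other letters therefore factorises over the boxes
-- into alternating sums over the subsets of admissible letters above the minimum, which vanish unless
-- no such letter exists: S is saturated. There is exactly one saturated tableau. Two of them agree,
-- by descending induction from the bottom right corner, since a larger entry in one would be
-- admissible in the other; one is obtained from the minima of any tableau by repeatedly raising an
-- entry to an admissible letter, which increases the bounded entry sum.
module Submission where

open import Defs
open import Data.Nat using (ℕ; _≤_)
open import Data.List using (List; [])
open import Data.Product using (_×_)
open import Relation.Binary.PropositionalEquality using (_≢_)

open import Data.Empty using (⊥)
open import Data.Unit using (⊤; tt)
open import Data.Nat using (zero; suc; _<_; _>_; z≤n; s≤s; _∸_; _%_; _≤′_; ≤′-step; ≤′-reflexive)
import Data.Nat as ℕ
import Data.Nat.Properties as ℕₚ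
open import Data.Nat.ListAction using (sum)
open import Data.Integer using (ℤ; +_; 0ℤ; 1ℤ; -1ℤ; _+_; _*_; _-_; -_; _^_)
import Data.Integer.Properties as ℤₚ
open import Data.Integer.Tactic.RingSolver using (solve-∀)
open import Data.List
  using (_∷_; _++_; map; concatMap; concat; foldr; filter; zipWith; length; replicate; applyUpTo; take; drop; head)
import Data.List.Properties as Listₚ
open import Data.List.Membership.Propositional using (_∈_; _∉_; find)
open import Data.List.Membership.Propositional.Properties
  using (∈-filter⁻; ∈-++⁻; ∈-++⁺ˡ; ∈-++⁺ʳ; ∈-map⁻; ∈-applyUpTo⁻; ∈-applyUpTo⁺)
open import Data.List.Membership.DecPropositional _≟B_ using (_∈?_)
open import Data.List.Membership.DecPropositional ℕ._≟_ using (_∉?_)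
open import Data.List.Relation.Binary.Subset.Propositional using (_⊆_)
open import Data.List.Relation.Binary.Pointwise as Pointwise using (Pointwise; []; _∷_)
open import Data.List.Relation.Unary.All as All using (All; []; _∷_; all?)
open import Data.List.Relation.Unary.All.Properties using (¬All⇒Any¬; concat⁺) renaming (map⁺ to All-map⁺)
open import Data.List.Relation.Unary.Any using (here; there)
open import Data.List.Relation.Unary.Linked as Linked using (Linked; []; _∷_)
open import Data.List.Relation.Unary.Unique.Propositional using (Unique; []; _∷_)
import Data.List.Relation.Unary.Unique.Propositional.Properties as Uniqueₚ
open import Data.Maybe using (fromMaybe)
open import Data.Product using (_,_; proj₁; proj₂; ∃; ∃₂)
open import Data.Sum using (_⊎_; inj₁; inj₂)
open import Function using (_∘_; _∘′_; id; _⇔_; mk⇔; Equivalence)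
open import Relation.Binary using (tri<; tri≈; tri>)
open import Relation.Binary.PropositionalEquality
open import Relation.Nullary using (Dec; yes; no; ¬_; ¬?; _×-dec_; _→-dec_)
open import Relation.Nullary.Decidable using (decidable-stable)
open import Relation.Nullary.Negation using (contradiction)
open import Relation.Unary using (Decidable)

-- Finite sums and products over lists

module _ {A : Set} where

  ∑ : List A → (A → ℤ) → ℤ
  ∑ []       f = 0ℤ
  ∑ (x ∷ xs) f = f x + ∑ xs f

  ∑-++ : ∀ xs ys (f : A → ℤ) → ∑ (xs ++ ys) f ≡ ∑ xs f + ∑ ys f
  ∑-++ []       ys f = sym (ℤₚ.+-identityˡ _)
  ∑-++ (x ∷ xs) ys f = trans (cong (_+_ (f x)) (∑-++ xs ys f)) (sym (ℤₚ.+-assoc (f x) _ _))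

  ∑-cong : ∀ xs {f g : A → ℤ} → (∀ {x} → x ∈ xs → f x ≡ g x) → ∑ xs f ≡ ∑ xs g
  ∑-cong []       f≗g = refl
  ∑-cong (x ∷ xs) f≗g = cong₂ _+_ (f≗g (here refl)) (∑-cong xs (f≗g ∘′ there))

  ∑-zero : ∀ xs → ∑ xs (λ _ → 0ℤ) ≡ 0ℤ
  ∑-zero []       = refl
  ∑-zero (x ∷ xs) = trans (ℤₚ.+-identityˡ _) (∑-zero xs)

  ∑-distrib-+ : ∀ xs (f g : A → ℤ) → ∑ xs (λ x → f x + g x) ≡ ∑ xs f + ∑ xs g
  ∑-distrib-+ []       f g = refl
  ∑-distrib-+ (x ∷ xs) f g = trans (cong (_+_ (f x + g x)) (∑-distrib-+ xs f g)) (swap (f x) (g x) _ _)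
    where
    swap : ∀ a b c d → a + b + (c + d) ≡ a + c + (b + d)
    swap = solve-∀

  *-distribˡ-∑ : ∀ c xs (f : A → ℤ) → c * ∑ xs f ≡ ∑ xs (λ x → c * f x)
  *-distribˡ-∑ c []       f = ℤₚ.*-zeroʳ c
  *-distribˡ-∑ c (x ∷ xs) f = trans (ℤₚ.*-distribˡ-+ c (f x) _) (cong (_+_ (c * f x)) (*-distribˡ-∑ c xs f))

  *-distribʳ-∑ : ∀ c xs (f : A → ℤ) → ∑ xs f * c ≡ ∑ xs (λ x → f x * c)
  *-distribʳ-∑ c xs f = trans (ℤₚ.*-comm _ c) (trans (*-distribˡ-∑ c xs f) (∑-cong xs (λ {x} _ → ℤₚ.*-comm c (f x))))

module _ {A B : Set} where

  ∑-map : ∀ (g : A → B) xs (f : B → ℤ) → ∑ (map g xs) f ≡ ∑ xs (λ x → f (g x))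
  ∑-map g []       f = refl
  ∑-map g (x ∷ xs) f = cong (_+_ (f (g x))) (∑-map g xs f)

  ∑-concatMap : ∀ (g : A → List B) xs (f : B → ℤ) → ∑ (concatMap g xs) f ≡ ∑ xs (λ x → ∑ (g x) f)
  ∑-concatMap g []       f = refl
  ∑-concatMap g (x ∷ xs) f = trans (∑-++ (g x) _ f) (cong (_+_ (∑ (g x) f)) (∑-concatMap g xs f))

  ∑-comm : ∀ xs ys (f : A → B → ℤ) → ∑ xs (λ x → ∑ ys (f x)) ≡ ∑ ys (λ y → ∑ xs (λ x → f x y))
  ∑-comm []       ys f = sym (∑-zero ys)
  ∑-comm (x ∷ xs) ys f =
    trans (cong (_+_ (∑ ys (f x))) (∑-comm xs ys f)) (sym (∑-distrib-+ ys (f x) (λ y → ∑ xs (λ x′ → f x′ y))))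

∏ : List ℤ → ℤ
∏ []       = 1ℤ
∏ (x ∷ xs) = x * ∏ xs

module _ {L A : Set} where

  ∏-zipWith-* : ∀ (f g : L → A → ℤ) ls ys →
                ∏ (zipWith f ls ys) * ∏ (zipWith g ls ys) ≡ ∏ (zipWith (λ l y → f l y * g l y) ls ys)
  ∏-zipWith-* f g []       _        = refl
  ∏-zipWith-* f g (_ ∷ _)  []       = refl
  ∏-zipWith-* f g (l ∷ ls) (y ∷ ys) =
    trans (regroup (f l y) (g l y) _ _) (cong (f l y * g l y *_) (∏-zipWith-* f g ls ys))
    where
    regroup : ∀ a b c d → a * c * (b * d) ≡ a * b * (c * d)
    regroup = solve-∀

𝟙 : {P : Set} → Dec P → ℤ
𝟙 (yes _) = 1ℤ
𝟙 (no _)  = 0ℤ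

module _ {P Q : Set} where

  𝟙-⇔ : (p : Dec P) (q : Dec Q) → (P → Q) → (Q → P) → 𝟙 p ≡ 𝟙 q
  𝟙-⇔ (yes _) (yes _) _   _   = refl
  𝟙-⇔ (yes p) (no ¬q) p→q _   = contradiction (p→q p) ¬q
  𝟙-⇔ (no ¬p) (yes q) _   q→p = contradiction (q→p q) ¬p
  𝟙-⇔ (no _)  (no _)  _   _   = refl

  𝟙-× : (p : Dec P) (q : Dec Q) → 𝟙 (p ×-dec q) ≡ 𝟙 p * 𝟙 q
  𝟙-× (yes _) (yes _) = refl
  𝟙-× (yes _) (no _)  = refl
  𝟙-× (no _)  q       = refl

𝟙-¬ : {P : Set} (p : Dec P) → 𝟙 (¬? p) ≡ 1ℤ - 𝟙 p
𝟙-¬ (yes _) = refl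
𝟙-¬ (no _)  = refl

module _ {A : Set} {P : A → Set} (P? : Decidable P) where

  ∑-filter : ∀ xs (f : A → ℤ) → ∑ (filter P? xs) f ≡ ∑ xs (λ x → 𝟙 (P? x) * f x)
  ∑-filter []       f = refl
  ∑-filter (x ∷ xs) f with P? x
  ... | yes _ = cong₂ _+_ (sym (ℤₚ.*-identityˡ (f x))) (∑-filter xs f)
  ... | no  _ = sym (trans (cong₂ _+_ (ℤₚ.*-zeroˡ (f x)) (sym (∑-filter xs f))) (ℤₚ.+-identityˡ _))

  𝟙-all-∷ : ∀ x xs → 𝟙 (all? P? (x ∷ xs)) ≡ 𝟙 (P? x) * 𝟙 (all? P? xs)
  𝟙-all-∷ x xs = trans (𝟙-⇔ (all? P? (x ∷ xs)) (P? x ×-dec all? P? xs) All.uncons (λ (p , ps) → p ∷ ps))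
                       (𝟙-× (P? x) (all? P? xs))

∑-𝟙≡length-filter : ∀ {A : Set} {P : A → Set} (P? : Decidable P) xs → ∑ xs (𝟙 ∘ P?) ≡ + length (filter P? xs)
∑-𝟙≡length-filter P? []       = refl
∑-𝟙≡length-filter P? (x ∷ xs) with P? x
... | yes _ = cong (_+_ 1ℤ) (∑-𝟙≡length-filter P? xs)
... | no  _ = trans (ℤₚ.+-identityˡ _) (∑-𝟙≡length-filter P? xs)

∑-1≡length : ∀ {A : Set} (xs : List A) → ∑ xs (λ _ → 1ℤ) ≡ + length xs
∑-1≡length []       = refl
∑-1≡length (x ∷ xs) = cong (_+_ 1ℤ) (∑-1≡length xs)

module _ {A B : Set} {R : A → B → Set} (R? : ∀ x y → Dec (R x y)) where

  𝟙-Pointwise : ∀ xs ys → length xs ≡ length ys →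
                𝟙 (Pointwise.decidable R? xs ys) ≡ ∏ (zipWith (λ x y → 𝟙 (R? x y)) xs ys)
  𝟙-Pointwise []       []       _  = refl
  𝟙-Pointwise (x ∷ xs) (y ∷ ys) eq =
    trans (𝟙-⇔ (Pointwise.decidable R? (x ∷ xs) (y ∷ ys)) (R? x y ×-dec Pointwise.decidable R? xs ys)
               Pointwise.uncons (λ (r , rs) → r ∷ rs))
    (trans (𝟙-× (R? x y) (Pointwise.decidable R? xs ys))
           (cong (_*_ (𝟙 (R? x y))) (𝟙-Pointwise xs ys (ℕₚ.suc-injective eq))))

-- Choice sequences

module _ {A : Set} where

  sequence : List (List A) → List (List A)
  sequence []         = [] ∷ []
  sequence (xs ∷ xss) = concatMap (λ x → map (x ∷_) (sequence xss)) xs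

  ∑-sequence-∷ : ∀ xs xss (f : List A → ℤ) →
                 ∑ (sequence (xs ∷ xss)) f ≡ ∑ xs (λ x → ∑ (sequence xss) (λ ys → f (x ∷ ys)))
  ∑-sequence-∷ xs xss f = trans (∑-concatMap _ xs f) (∑-cong xs (λ {x} _ → ∑-map (x ∷_) (sequence xss) f))

  ∑-sequence-∏ : {L : Set} (φ : L → A → ℤ) → ∀ ls xss → length ls ≡ length xss →
    ∑ (sequence xss) (λ ys → ∏ (zipWith φ ls ys)) ≡ ∏ (zipWith (λ l xs → ∑ xs (φ l)) ls xss)
  ∑-sequence-∏ φ []       []         _  = refl
  ∑-sequence-∏ φ (l ∷ ls) (xs ∷ xss) eq = begin
      ∑ (sequence (xs ∷ xss)) (λ ys → ∏ (zipWith φ (l ∷ ls) ys))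
    ≡⟨ ∑-sequence-∷ xs xss _ ⟩
      ∑ xs (λ y → ∑ (sequence xss) (λ ys → φ l y * ∏ (zipWith φ ls ys)))
    ≡⟨ ∑-cong xs (λ {y} _ → sym (*-distribˡ-∑ (φ l y) (sequence xss) _)) ⟩
      ∑ xs (λ y → φ l y * ∑ (sequence xss) (λ ys → ∏ (zipWith φ ls ys)))
    ≡⟨ sym (*-distribʳ-∑ _ xs (φ l)) ⟩
      ∑ xs (φ l) * ∑ (sequence xss) (λ ys → ∏ (zipWith φ ls ys))
    ≡⟨ cong (_*_ (∑ xs (φ l))) (∑-sequence-∏ φ ls xss (ℕₚ.suc-injective eq)) ⟩
      ∏ (zipWith (λ l xs → ∑ xs (φ l)) (l ∷ ls) (xs ∷ xss))
    ∎
    where open ≡-Reasoning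

module _ {A : Set} where

  ∈-sequence⁻ : ∀ xss {ys : List A} → ys ∈ sequence xss → Pointwise _∈_ ys xss
  ∈-sequence⁻ []         (here refl) = []
  ∈-sequence⁻ (xs ∷ xss) ys∈         = choose xs ys∈
    where
    choose : ∀ xs′ {ys} → ys ∈ concatMap (λ x → map (x ∷_) (sequence xss)) xs′ → Pointwise _∈_ ys (xs′ ∷ xss)
    choose (x ∷ xs′) ys∈ with ∈-++⁻ (map (x ∷_) (sequence xss)) ys∈
    ... | inj₁ ys∈x∷ with ∈-map⁻ (x ∷_) ys∈x∷
    ...   | ys′ , ys′∈ , refl = here refl ∷ ∈-sequence⁻ xss ys′∈
    choose (x ∷ xs′) ys∈ | inj₂ ys∈rest with choose xs′ ys∈rest
    ... | y∈ ∷ ys∈xss = there y∈ ∷ ys∈xss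

∈-sequence-replicate⁻ : ∀ {A : Set} {xs : List A} k {ys} → ys ∈ sequence (replicate k xs) → length ys ≡ k × All (_∈ xs) ys
∈-sequence-replicate⁻ {xs = xs} k ys∈ = go k (∈-sequence⁻ (replicate k xs) ys∈)
  where
  go : ∀ k {ys} → Pointwise _∈_ ys (replicate k xs) → length ys ≡ k × All (_∈ xs) ys
  go zero    []          = refl , []
  go (suc k) (y∈ ∷ ys∈) = let (|ys| , ys⊆) = go k ys∈ in cong suc |ys| , y∈ ∷ ys⊆

module _ {A : Set} (ys : List (List A)) (xs : List A) (U : A → List (List A))
         (split : ∀ f → ∑ ys f ≡ ∑ xs (λ x → ∑ (U x) (λ e → f (x ∷ e)))) where

  ∑-sequence-split : ∀ m (F : List (List A) → ℤ) →
    ∑ (sequence (replicate m ys)) F ≡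
    ∑ (sequence (replicate m xs)) (λ X → ∑ (sequence (map U X)) (λ E → F (zipWith _∷_ X E)))
  ∑-sequence-split zero    F = cong (_+ 0ℤ) (sym (ℤₚ.+-identityʳ (F [])))
  ∑-sequence-split (suc m) F = begin
      ∑ (sequence (ys ∷ replicate m ys)) F
    ≡⟨ ∑-sequence-∷ ys (replicate m ys) F ⟩
      ∑ ys (λ s → ∑ (sequence (replicate m ys)) (λ Ts → F (s ∷ Ts)))
    ≡⟨ ∑-cong ys (λ {s} _ → ∑-sequence-split m (λ Ts → F (s ∷ Ts))) ⟩
      ∑ ys (λ s → ∑ Xs (λ X → ∑ (sequence (map U X)) (λ E → F (s ∷ zipWith _∷_ X E))))
    ≡⟨ split _ ⟩
      ∑ xs (λ x → ∑ (U x) (λ e → ∑ Xs (λ X → ∑ (sequence (map U X)) (λ E → F ((x ∷ e) ∷ zipWith _∷_ X E)))))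
    ≡⟨ ∑-cong xs (λ {x} _ → ∑-comm (U x) Xs _) ⟩
      ∑ xs (λ x → ∑ Xs (λ X → ∑ (U x) (λ e → ∑ (sequence (map U X)) (λ E → F ((x ∷ e) ∷ zipWith _∷_ X E)))))
    ≡⟨ ∑-cong xs (λ {x} _ → ∑-cong Xs (λ {X} _ → sym (∑-sequence-∷ (U x) (map U X) _))) ⟩
      ∑ xs (λ x → ∑ Xs (λ X → ∑ (sequence (map U (x ∷ X))) (λ E → F (zipWith _∷_ (x ∷ X) E))))
    ≡⟨ sym (∑-sequence-∷ xs (replicate m xs) _) ⟩
      ∑ (sequence (xs ∷ replicate m xs)) (λ X → ∑ (sequence (map U X)) (λ E → F (zipWith _∷_ X E)))
    ∎
    where
    open ≡-Reasoning
    Xs = sequence (replicate m xs)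

-- Ranges of letters and their subsets

range : ℕ → ℕ → List ℕ
range a zero    = []
range a (suc k) = a ∷ range (suc a) k

applyUpTo-range : ∀ (f : ℕ → ℕ) a k → (∀ t → f t ≡ a ℕ.+ t) → applyUpTo f k ≡ range a k
applyUpTo-range f a zero    f≗a+ = refl
applyUpTo-range f a (suc k) f≗a+ = cong₂ _∷_ (trans (f≗a+ 0) (ℕₚ.+-identityʳ a))
  (applyUpTo-range (f ∘ suc) (suc a) k (λ t → trans (f≗a+ (suc t)) (ℕₚ.+-suc a t)))

∈-range⁻ : ∀ {a k c} → c ∈ range a k → a ≤ c × c < a ℕ.+ k
∈-range⁻ {a} {suc k} (here refl) = ℕₚ.≤-refl , ℕₚ.m<m+n a (s≤s z≤n)
∈-range⁻ {a} {suc k} {c} (there c∈) with ∈-range⁻ c∈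
... | a<c , c<1+a+k = ℕₚ.<⇒≤ a<c , subst (c <_) (sym (ℕₚ.+-suc a k)) c<1+a+k

∈-range⁺ : ∀ {a k c} → a ≤ c → c < a ℕ.+ k → c ∈ range a k
∈-range⁺ {a} {zero}  {c} a≤c c<a+0 = contradiction (subst (c <_) (ℕₚ.+-identityʳ a) c<a+0) (ℕₚ.≤⇒≯ a≤c)
∈-range⁺ {a} {suc k} {c} a≤c c<a+k with a ℕ.≟ c
... | yes refl = here refl
... | no  a≢c  = there (∈-range⁺ (ℕₚ.≤∧≢⇒< a≤c a≢c) (subst (c <_) (ℕₚ.+-suc a k) c<a+k))

∑-range-𝟙-below : ∀ {v} a k → v < a → ∑ (range a k) (λ j → 𝟙 (v ℕ.≟ j)) ≡ 0ℤ
∑-range-𝟙-below     a zero    v<a = refl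
∑-range-𝟙-below {v} a (suc k) v<a with v ℕ.≟ a
... | yes refl = contradiction v<a (ℕₚ.<-irrefl refl)
... | no  _    = trans (ℤₚ.+-identityˡ _) (∑-range-𝟙-below (suc a) k (ℕₚ.m<n⇒m<1+n v<a))

∑-range-𝟙 : ∀ {v} a k → a ≤ v → v < a ℕ.+ k → ∑ (range a k) (λ j → 𝟙 (v ℕ.≟ j)) ≡ 1ℤ
∑-range-𝟙 {v} a zero    a≤v v<a+0 = contradiction (subst (v <_) (ℕₚ.+-identityʳ a) v<a+0) (ℕₚ.≤⇒≯ a≤v)
∑-range-𝟙 {v} a (suc k) a≤v v<a+k with v ℕ.≟ a
... | yes refl = cong (_+_ 1ℤ) (∑-range-𝟙-below (suc v) k ℕₚ.≤-refl)
... | no  v≢a  = trans (ℤₚ.+-identityˡ _)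
                       (∑-range-𝟙 (suc a) k (ℕₚ.≤∧≢⇒< a≤v (v≢a ∘ sym)) (subst (v <_) (ℕₚ.+-suc a k) v<a+k))

letters≡range : ∀ n → letters n ≡ range 1 (2 ℕ.* n)
letters≡range n = applyUpTo-range suc 1 (2 ℕ.* n) (λ _ → refl)

NonEmpty : List ℕ → Set
NonEmpty s = ∃₂ λ x e → s ≡ x ∷ e

∈-subsets⁻ : ∀ {A : Set} (xs : List A) {e} → e ∈ subsets xs → e ⊆ xs
∈-subsets⁻ []       (here refl) ()
∈-subsets⁻ (x ∷ xs) e∈ with ∈-++⁻ (map (x ∷_) (subsets xs)) e∈
... | inj₂ e∈xs = there ∘ ∈-subsets⁻ xs e∈xs
... | inj₁ e∈x∷ with ∈-map⁻ (x ∷_) e∈x∷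
...   | e′ , e′∈ , refl = λ { (here refl) → here refl ; (there c∈) → there (∈-subsets⁻ xs e′∈ c∈) }

∈-nonemptySubsets⁻ : ∀ xs {s} → s ∈ nonemptySubsets xs → NonEmpty s × s ⊆ xs
∈-nonemptySubsets⁻ (x ∷ xs) s∈ with ∈-++⁻ (map (x ∷_) (subsets xs)) s∈
... | inj₂ s∈xs = let (ne , s⊆) = ∈-nonemptySubsets⁻ xs s∈xs in ne , there ∘ s⊆
... | inj₁ s∈x∷ with ∈-map⁻ (x ∷_) s∈x∷
...   | e , e∈ , refl = (x , e , refl) , λ { (here refl) → here refl ; (there c∈) → there (∈-subsets⁻ xs e∈ c∈) }

module _ {A : Set} {P : A → Set} (P? : Decidable P) where

  ∑-subsets-alternating : ∀ xs →
    ∑ (subsets xs) (λ e → 𝟙 (all? P? e) * -1ℤ ^ length e) ≡ 𝟙 (all? (¬? ∘ P?) xs)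
  ∑-subsets-alternating []       = refl
  ∑-subsets-alternating (x ∷ xs) = begin
      ∑ (map (x ∷_) (subsets xs) ++ subsets xs) w
    ≡⟨ ∑-++ (map (x ∷_) (subsets xs)) _ w ⟩
      ∑ (map (x ∷_) (subsets xs)) w + ∑ (subsets xs) w
    ≡⟨ cong (_+ ∑ (subsets xs) w) (trans (∑-map (x ∷_) (subsets xs) w) (∑-cong (subsets xs) (λ {e} _ → w-∷ e))) ⟩
      ∑ (subsets xs) (λ e → - 𝟙 (P? x) * w e) + ∑ (subsets xs) w
    ≡⟨ cong (_+ ∑ (subsets xs) w) (sym (*-distribˡ-∑ (- 𝟙 (P? x)) (subsets xs) w)) ⟩
      - 𝟙 (P? x) * ∑ (subsets xs) w + ∑ (subsets xs) w
    ≡⟨ cong (λ s → - 𝟙 (P? x) * s + s) (∑-subsets-alternating xs) ⟩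
      - 𝟙 (P? x) * 𝟙 (all? (¬? ∘ P?) xs) + 𝟙 (all? (¬? ∘ P?) xs)
    ≡⟨ factor (𝟙 (P? x)) _ ⟩
      (1ℤ - 𝟙 (P? x)) * 𝟙 (all? (¬? ∘ P?) xs)
    ≡⟨ sym (trans (𝟙-all-∷ (¬? ∘ P?) x xs) (cong (_* 𝟙 (all? (¬? ∘ P?) xs)) (𝟙-¬ (P? x)))) ⟩
      𝟙 (all? (¬? ∘ P?) (x ∷ xs))
    ∎
    where
    open ≡-Reasoning
    w : List A → ℤ
    w e = 𝟙 (all? P? e) * -1ℤ ^ length e
    factor : ∀ a s → - a * s + s ≡ (1ℤ - a) * s
    factor = solve-∀
    regroup : ∀ a b c → a * b * (-1ℤ * c) ≡ - a * (b * c)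
    regroup = solve-∀
    w-∷ : ∀ e → w (x ∷ e) ≡ - 𝟙 (P? x) * w e
    w-∷ e = trans (cong (_* -1ℤ ^ length (x ∷ e)) (𝟙-all-∷ P? x e)) (regroup (𝟙 (P? x)) (𝟙 (all? P? e)) _)

module _ (top : ℕ) where

  above : ℕ → List ℕ
  above x = range (suc x) (top ∸ x)

  ∑-nonemptySubsets-range : ∀ a k → a ℕ.+ k ≡ suc top → (f : List ℕ → ℤ) →
    ∑ (nonemptySubsets (range a k)) f ≡ ∑ (range a k) (λ x → ∑ (subsets (above x)) (λ e → f (x ∷ e)))
  ∑-nonemptySubsets-range a zero    _   f = refl
  ∑-nonemptySubsets-range a (suc k) a+k f = begin
      ∑ (map (a ∷_) (subsets (range (suc a) k)) ++ nonemptySubsets (range (suc a) k)) f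
    ≡⟨ ∑-++ (map (a ∷_) (subsets (range (suc a) k))) _ f ⟩
      ∑ (map (a ∷_) (subsets (range (suc a) k))) f + ∑ (nonemptySubsets (range (suc a) k)) f
    ≡⟨ cong₂ _+_ (trans (∑-map (a ∷_) (subsets (range (suc a) k)) f)
                        (cong (λ r → ∑ (subsets r) (λ e → f (a ∷ e))) range≡above))
                 (∑-nonemptySubsets-range (suc a) k (trans (sym (ℕₚ.+-suc a k)) a+k) f) ⟩
      ∑ (range a (suc k)) (λ x → ∑ (subsets (above x)) (λ e → f (x ∷ e)))
    ∎
    where
    open ≡-Reasoning
    range≡above : range (suc a) k ≡ above a
    range≡above = cong (range (suc a)) (sym (trans (cong (_∸ a) (sym a+k≡top)) (ℕₚ.m+n∸m≡n a k)))
      where a+k≡top = ℕₚ.suc-injective (trans (sym (ℕₚ.+-suc a k)) a+k)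

module _ (n : ℕ) where

  private
    top = 2 ℕ.* n

  ∈-letters⁻ : ∀ {c} → c ∈ letters n → 1 ≤ c × c ≤ top
  ∈-letters⁻ {c} c∈ with ∈-range⁻ (subst (c ∈_) (letters≡range n) c∈)
  ... | 1≤c , c<1+top = 1≤c , ℕₚ.≤-pred c<1+top

  ∈-letters⁺ : ∀ {c} → 1 ≤ c → c ≤ top → c ∈ letters n
  ∈-letters⁺ {c} 1≤c c≤top = subst (c ∈_) (sym (letters≡range n)) (∈-range⁺ 1≤c (s≤s c≤top))

  ∈-above⁺ : ∀ {x c} → x < c → c ∈ letters n → c ∈ above top x
  ∈-above⁺ {x} {c} x<c c∈ = ∈-range⁺ x<c (s≤s (subst (c ≤_) (sym (ℕₚ.m+[n∸m]≡n x≤top)) c≤top))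
    where
    c≤top = proj₂ (∈-letters⁻ c∈)
    x≤top = ℕₚ.≤-trans (ℕₚ.<⇒≤ x<c) c≤top

  ∈-above⁻ : ∀ {x c} → x ≤ top → c ∈ above top x → x < c × c ∈ letters n
  ∈-above⁻ {x} {c} x≤top c∈ with ∈-range⁻ c∈
  ... | x<c , c<end =
    x<c , ∈-letters⁺ (ℕₚ.≤-trans (s≤s z≤n) x<c) (ℕₚ.≤-pred (subst (c <_) (cong suc (ℕₚ.m+[n∸m]≡n x≤top)) c<end))

  ∑-letters-𝟙 : ∀ {x} → x ∈ letters n → ∑ (letters n) (λ y → 𝟙 (x ℕ.≟ y)) ≡ 1ℤ
  ∑-letters-𝟙 {x} x∈ = trans (cong (λ ys → ∑ ys (λ y → 𝟙 (x ℕ.≟ y))) (letters≡range n))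
                             (∑-range-𝟙 1 top (proj₁ (∈-letters⁻ x∈)) (s≤s (proj₂ (∈-letters⁻ x∈))))

fillings≡sequence : ∀ n m → fillings n m ≡ sequence (replicate m (nonemptySubsets (letters n)))
fillings≡sequence n zero    = refl
fillings≡sequence n (suc m) = cong (λ Ts → concatMap (λ s → map (s ∷_) Ts) (nonemptySubsets (letters n)))
                                   (fillings≡sequence n m)

-- Specialising the Laurent polynomial

monomial : ℤ → ℤ → LPoly
monomial c f = (c , f) ∷ []

β^ : ∀ k → βL ^L k ≡ monomial 1ℤ (+ k)
β^ zero    = refl
β^ (suc k) rewrite β^ k = refl

-- −1 + −k reduces to −(1 + k) only for k = 0 or a successor, hence the two base cases.
-β⁻¹^ : ∀ k → -βinv ^L k ≡ monomial (-1ℤ ^ k) (- (+ k))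
-β⁻¹^ zero          = refl
-β⁻¹^ (suc zero)    = refl
-β⁻¹^ (suc (suc k)) rewrite -β⁻¹^ (suc k) = refl

∏-β^ : ∀ (g : ℕ → ℕ) ks → foldr _*L_ oneL (map (λ k → βL ^L g k) ks) ≡ monomial 1ℤ (∑ ks (λ k → + g k))
∏-β^ g []       = refl
∏-β^ g (k ∷ ks) rewrite ∏-β^ g ks | β^ (g k) = refl

coeff-++ : ∀ p q e → coeff (p ++ q) e ≡ coeff p e + coeff q e
coeff-++ []            q e = sym (ℤₚ.+-identityˡ _)
coeff-++ ((c , f) ∷ p) q e with f ℤₚ.≟ e
... | yes _ = trans (cong (_+_ c) (coeff-++ p q e)) (sym (ℤₚ.+-assoc c _ _))
... | no  _ = coeff-++ p q e

coeff-concatMap : ∀ {A : Set} (g : A → LPoly) xs e → coeff (concatMap g xs) e ≡ ∑ xs (λ x → coeff (g x) e)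
coeff-concatMap g []       e = refl
coeff-concatMap g (x ∷ xs) e = trans (coeff-++ (g x) _ e) (cong (_+_ (coeff (g x) e)) (coeff-concatMap g xs e))

coeff-monomial : ∀ c f e → coeff (monomial c f) e ≡ c * coeff (monomial 1ℤ f) e
coeff-monomial c f e with f ℤₚ.≟ e
... | yes _ = trans (ℤₚ.+-identityʳ c) (sym (ℤₚ.*-identityʳ c))
... | no  _ = sym (ℤₚ.*-zeroʳ c)

card≡length-concat : ∀ T → card T ≡ length (concat T)
card≡length-concat []      = refl
card≡length-concat (s ∷ T) = trans (cong (length s ℕ.+_) (card≡length-concat T)) (sym (Listₚ.length-++ s))

index-bounds : ∀ n {c} → c ∈ letters n → 1 ≤ index c × index c < 1 ℕ.+ n
index-bounds n {c} c∈ with ∈-letters⁻ n c∈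
... | 1≤c , c≤2n = positive 1≤c , s≤s (≤-half n c (subst (c ≤_) (cong (n ℕ.+_) (ℕₚ.+-identityʳ n)) c≤2n))
  where
  positive : ∀ {c} → 1 ≤ c → 1 ≤ index c
  positive {suc c} _ = s≤s z≤n
  ≤-half : ∀ n c → c ≤ n ℕ.+ n → index c ≤ n
  ≤-half n       zero          _           = z≤n
  ≤-half (suc n) (suc zero)    _           = s≤s z≤n
  ≤-half (suc n) (suc (suc c)) (s≤s c≤n+n) =
    s≤s (≤-half n c (ℕₚ.≤-pred (subst (suc c ≤_) (ℕₚ.+-suc n n) c≤n+n)))

∑-ω≡card : ∀ n T → All (_∈ letters n) (concat T) → ∑ (applyUpTo suc n) (λ k → + ω k T) ≡ + card T
∑-ω≡card n T T∈ = begin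
    ∑ ks (λ k → + ω k T)
  ≡⟨ ∑-cong ks (λ {k} _ → sym (∑-𝟙≡length-filter (λ c → index c ℕ.≟ k) (concat T))) ⟩
    ∑ ks (λ k → ∑ (concat T) (λ c → 𝟙 (index c ℕ.≟ k)))
  ≡⟨ ∑-comm ks (concat T) _ ⟩
    ∑ (concat T) (λ c → ∑ ks (λ k → 𝟙 (index c ℕ.≟ k)))
  ≡⟨ ∑-cong (concat T) (λ c∈ → ∑-once (All.lookup T∈ c∈)) ⟩
    ∑ (concat T) (λ _ → 1ℤ)
  ≡⟨ ∑-1≡length (concat T) ⟩
    + length (concat T)
  ≡⟨ cong +_ (sym (card≡length-concat T)) ⟩
    + card T
  ∎
  where
  open ≡-Reasoning
  ks = applyUpTo suc n
  ∑-once : ∀ {c} → c ∈ letters n → ∑ ks (λ k → 𝟙 (index c ℕ.≟ k)) ≡ 1ℤ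
  ∑-once c∈ with index-bounds n c∈
  ... | lo , hi rewrite applyUpTo-range suc 1 n (λ _ → refl) = ∑-range-𝟙 1 n lo hi

module _ (lam : List ℕ) (n : ℕ) where

  term : Filling → LPoly
  term T = (-βinv ^L (card T ∸ size lam)) *L foldr _*L_ oneL (map (λ k → βL ^L ω k T) (applyUpTo suc n))

  coeff-term : ∀ T → All (_∈ letters n) (concat T) → size lam ≤ card T → ∀ e →
    coeff (term T) e ≡ -1ℤ ^ (card T ∸ size lam) * coeff (βL ^L size lam) e
  coeff-term T T∈ |λ|≤|T| e = begin
      coeff (term T) e
    ≡⟨ cong (λ p → coeff p e) (cong₂ _*L_ (-β⁻¹^ a) (∏-β^ (λ k → ω k T) (applyUpTo suc n))) ⟩
      coeff (monomial (-1ℤ ^ a * 1ℤ) (- (+ a) + ∑ (applyUpTo suc n) (λ k → + ω k T))) e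
    ≡⟨ cong₂ (λ c f → coeff (monomial c f) e) (ℤₚ.*-identityʳ _) exponent ⟩
      coeff (monomial (-1ℤ ^ a) (+ size lam)) e
    ≡⟨ coeff-monomial (-1ℤ ^ a) (+ size lam) e ⟩
      -1ℤ ^ a * coeff (monomial 1ℤ (+ size lam)) e
    ≡⟨ cong (λ p → -1ℤ ^ a * coeff p e) (sym (β^ (size lam))) ⟩
      -1ℤ ^ a * coeff (βL ^L size lam) e
    ∎
    where
    open ≡-Reasoning
    a = card T ∸ size lam
    cancel : ∀ a s → - a + (s + a) ≡ s
    cancel = solve-∀
    exponent : - (+ a) + ∑ (applyUpTo suc n) (λ k → + ω k T) ≡ + size lam
    exponent = begin
        - (+ a) + ∑ (applyUpTo suc n) (λ k → + ω k T)
      ≡⟨ cong (λ s → - (+ a) + s) (∑-ω≡card n T T∈) ⟩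
        - (+ a) + + card T
      ≡⟨ cong (λ s → - (+ a) + + s) (sym (ℕₚ.m+[n∸m]≡n |λ|≤|T|)) ⟩
        - (+ a) + (+ size lam + + a)
      ≡⟨ cancel (+ a) (+ size lam) ⟩
        + size lam
      ∎

  coeff-evalG-β : ∀ Ts → All (λ T → All (_∈ letters n) (concat T) × size lam ≤ card T) Ts → ∀ e →
    coeff (evalG lam n Ts (λ _ → βL) -βinv) e ≡ ∑ Ts (λ T → -1ℤ ^ (card T ∸ size lam)) * coeff (βL ^L size lam) e
  coeff-evalG-β Ts Ts-ok e = begin
      coeff (concatMap term Ts) e
    ≡⟨ coeff-concatMap term Ts e ⟩
      ∑ Ts (λ T → coeff (term T) e)
    ≡⟨ ∑-cong Ts (λ {T} T∈ → let (T-letters , |λ|≤|T|) = All.lookup Ts-ok T∈ in coeff-term T T-letters |λ|≤|T| e) ⟩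
      ∑ Ts (λ T → -1ℤ ^ (card T ∸ size lam) * coeff (βL ^L size lam) e)
    ≡⟨ sym (*-distribʳ-∑ _ Ts _) ⟩
      ∑ Ts (λ T → -1ℤ ^ (card T ∸ size lam)) * coeff (βL ^L size lam) e
    ∎
    where open ≡-Reasoning

at-here : ∀ b B y Y → at (b ∷ B) (y ∷ Y) b ≡ y
at-here b B y Y with b ≟B b
... | yes _  = refl
... | no b≢b = contradiction refl b≢b

at-there : ∀ {b b′} B y Y → b ≢ b′ → at (b ∷ B) (y ∷ Y) b′ ≡ at B Y b′
at-there {b} {b′} B y Y b≢b′ with b ≟B b′
... | yes b≡b′ = contradiction b≡b′ b≢b′
... | no  _    = refl

at-∉ : ∀ B Y {b} → b ∉ B → at B Y b ≡ []
at-∉ []      Y       b∉ = refl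
at-∉ (_ ∷ _) []      b∉ = refl
at-∉ (b′ ∷ B) (y ∷ Y) {b} b∉ with b′ ≟B b
... | yes refl = contradiction (here refl) b∉
... | no  _    = at-∉ B Y (b∉ ∘′ there)

at-map : ∀ (f : List ℕ → List ℕ) → f [] ≡ [] → ∀ B Y b → at B (map f Y) b ≡ f (at B Y b)
at-map f f[] []       Y       b = sym f[]
at-map f f[] (_ ∷ _)  []      b = sym f[]
at-map f f[] (b′ ∷ B) (y ∷ Y) b with b′ ≟B b
... | yes _ = refl
... | no  _ = at-map f f[] B Y b

at-map-self : ∀ (g : Box → List ℕ) B {b} → b ∈ B → at B (map g B) b ≡ g b
at-map-self g (b′ ∷ B) {b} b∈ with b′ ≟B b | b∈
... | yes refl | _          = refl
... | no  b′≢b | here refl  = contradiction refl b′≢b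
... | no  _    | there b∈B  = at-map-self g B b∈B

at-All : ∀ {P : List ℕ → Set} → P [] → ∀ {Y} → All P Y → ∀ B b → P (at B Y b)
at-All P[] []       []      b = P[]
at-All P[] []       (_ ∷ _) b = P[]
at-All P[] (_ ∷ _)  []      b = P[]
at-All P[] (p ∷ ps) (b′ ∷ B) b with b′ ≟B b
... | yes _ = p
... | no  _ = at-All P[] ps B b

module _ {Q : Box → List ℕ → Set} where

  at-Pointwise : ∀ {B Y} → Pointwise Q B Y → ∀ {b} → b ∈ B → Q b (at B Y b)
  at-Pointwise {b′ ∷ B} {y ∷ Y} (q ∷ qs) {b} b∈ with b′ ≟B b | b∈
  ... | yes refl | _         = q
  ... | no  b′≢b | here refl = contradiction refl b′≢b
  ... | no  _    | there b∈B = at-Pointwise qs b∈B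

  Pointwise-at : ∀ {B Y} → Unique B → length Y ≡ length B → (∀ {b} → b ∈ B → Q b (at B Y b)) → Pointwise Q B Y
  Pointwise-at {[]}    {[]}    _            _   _ = []
  Pointwise-at {b ∷ B} {y ∷ Y} (b∉B ∷ uB) eq q =
    subst (Q b) (at-here b B y Y) (q (here refl)) ∷
    Pointwise-at uB (ℕₚ.suc-injective eq) (λ {b′} b′∈ → subst (Q b′) (at-there B y Y (All.lookup b∉B b′∈)) (q (there b′∈)))

Pointwise-≡⇒map : ∀ {f : Box → List ℕ} {B Y} → Pointwise (λ b y → f b ≡ y) B Y → map f B ≡ Y
Pointwise-≡⇒map []         = refl
Pointwise-≡⇒map (eq ∷ eqs) = cong₂ _∷_ eq (Pointwise-≡⇒map eqs)

at-injective : ∀ {B} Y Z → Unique B → length Y ≡ length B → length Z ≡ length B →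
               (∀ {b} → b ∈ B → at B Y b ≡ at B Z b) → Y ≡ Z
at-injective {B} Y Z uB |Y| |Z| Y≗Z = begin
    Y                 ≡⟨ sym (Pointwise-≡⇒map (Pointwise-at uB |Y| (λ _ → refl))) ⟩
    map (at B Y) B    ≡⟨ Listₚ.map-cong-local (All.tabulate Y≗Z) ⟩
    map (at B Z) B    ≡⟨ Pointwise-≡⇒map (Pointwise-at uB |Z| (λ _ → refl)) ⟩
    Z                 ∎
  where open ≡-Reasoning

All⇒Pointwise : ∀ {A B : Set} {P : B → Set} {xs : List A} {ys} → length xs ≡ length ys → All P ys →
                Pointwise (λ _ y → P y) xs ys
All⇒Pointwise {xs = []}     {[]}    _  []       = []
All⇒Pointwise {xs = _ ∷ _}  {_ ∷ _} eq (p ∷ ps) = p ∷ All⇒Pointwise (ℕₚ.suc-injective eq) ps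

Pointwise-mapʳ⁻ : ∀ {A B C : Set} {R : A → C → Set} {f : B → C} {ys xs} → Pointwise R ys (map f xs) →
                  Pointwise (λ y x → R y (f x)) ys xs
Pointwise-mapʳ⁻ {xs = []}    []       = []
Pointwise-mapʳ⁻ {xs = _ ∷ _} (r ∷ rs) = r ∷ Pointwise-mapʳ⁻ rs

module _ {Q : Box → List ℕ → Set} where

  Pointwise-zipWith-∷⁺ : ∀ {B X E} → length X ≡ length E → Pointwise Q B E →
                         Pointwise (λ b t → Q b (drop 1 t)) B (zipWith _∷_ X E)
  Pointwise-zipWith-∷⁺ {X = []}    {[]}    _  []       = []
  Pointwise-zipWith-∷⁺ {X = _ ∷ _} {_ ∷ _} eq (q ∷ qs) = q ∷ Pointwise-zipWith-∷⁺ (ℕₚ.suc-injective eq) qs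

  Pointwise-zipWith-∷⁻ : ∀ {B X E} → length X ≡ length E →
                         Pointwise (λ b t → Q b (drop 1 t)) B (zipWith _∷_ X E) → Pointwise Q B E
  Pointwise-zipWith-∷⁻ {X = []}    {[]}    _  []       = []
  Pointwise-zipWith-∷⁻ {X = _ ∷ _} {_ ∷ _} eq (q ∷ qs) = q ∷ Pointwise-zipWith-∷⁻ (ℕₚ.suc-injective eq) qs

-- Shifted diagrams

RowConvex : List Box → Set
RowConvex B = ∀ {r j l} → (r , j) ∈ B → (r , l) ∈ B → j < l → (r , suc j) ∈ B

ColumnConvex : List Box → Set
ColumnConvex B = ∀ {i k j} → (i , j) ∈ B → (k , j) ∈ B → i < k → (suc i , j) ∈ B

row-segment : ℕ → ℕ → List Box
row-segment i a = applyUpTo (λ t → (i , i ℕ.+ t)) a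

∈-row-segment⁻ : ∀ {i a r c} → (r , c) ∈ row-segment i a → r ≡ i × i ≤ c × c < i ℕ.+ a
∈-row-segment⁻ {i} b∈ with ∈-applyUpTo⁻ (λ t → (i , i ℕ.+ t)) b∈
... | t , t<a , refl = refl , ℕₚ.m≤m+n i t , ℕₚ.+-monoʳ-< i t<a

∈-row-segment⁺ : ∀ {i a c} → i ≤ c → c < i ℕ.+ a → (i , c) ∈ row-segment i a
∈-row-segment⁺ {i} {a} {c} i≤c c<i+a = subst (λ c′ → (i , c′) ∈ row-segment i a) (ℕₚ.m+[n∸m]≡n i≤c)
  (∈-applyUpTo⁺ (λ t → (i , i ℕ.+ t)) (ℕₚ.+-cancelˡ-< i _ _ (subst (_< i ℕ.+ a) (sym (ℕₚ.m+[n∸m]≡n i≤c)) c<i+a)))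

∈-boxesFrom⁻ : ∀ i lam {r c} → (r , c) ∈ boxesFrom i lam → i ≤ r × r ≤ c
∈-boxesFrom⁻ i (a ∷ rest) b∈ with ∈-++⁻ (row-segment i a) b∈
... | inj₁ b∈row with ∈-row-segment⁻ b∈row
...   | refl , r≤c , _ = ℕₚ.≤-refl , r≤c
∈-boxesFrom⁻ i (a ∷ rest) b∈ | inj₂ b∈rest with ∈-boxesFrom⁻ (suc i) rest b∈rest
... | i<r , r≤c = ℕₚ.<⇒≤ i<r , r≤c

∈-boxesFrom-col< : ∀ i a rest {r c} → Linked _>_ (a ∷ rest) → (r , c) ∈ boxesFrom i (a ∷ rest) → c < i ℕ.+ a
∈-boxesFrom-col< i a rest dec b∈ with ∈-++⁻ (row-segment i a) b∈
... | inj₁ b∈row = proj₂ (proj₂ (∈-row-segment⁻ b∈row))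
∈-boxesFrom-col< i a (a′ ∷ rest) (a>a′ ∷ dec) b∈ | inj₂ b∈rest =
  ℕₚ.<-≤-trans (∈-boxesFrom-col< (suc i) a′ rest dec b∈rest)
               (subst (_≤ i ℕ.+ a) (ℕₚ.+-suc i a′) (ℕₚ.+-monoʳ-≤ i a>a′))

boxesFrom-rowConvex : ∀ i lam → Linked _>_ lam → RowConvex (boxesFrom i lam)
boxesFrom-rowConvex i (a ∷ rest) dec b∈ b′∈ j<l with ∈-++⁻ (row-segment i a) b∈ | ∈-++⁻ (row-segment i a) b′∈
... | inj₁ b∈row | inj₁ b′∈row with ∈-row-segment⁻ b∈row | ∈-row-segment⁻ b′∈row
...   | refl , i≤j , _ | _ , _ , l<i+a =
        ∈-++⁺ˡ (∈-row-segment⁺ (ℕₚ.≤-trans i≤j (ℕₚ.n≤1+n _)) (ℕₚ.≤-<-trans j<l l<i+a))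
boxesFrom-rowConvex i (a ∷ rest) dec b∈ b′∈ j<l | inj₁ b∈row | inj₂ b′∈rest
  with ∈-row-segment⁻ b∈row | ∈-boxesFrom⁻ (suc i) rest b′∈rest
... | refl , _ | i<i , _ = contradiction i<i (ℕₚ.<-irrefl refl)
boxesFrom-rowConvex i (a ∷ rest) dec b∈ b′∈ j<l | inj₂ b∈rest | inj₁ b′∈row
  with ∈-row-segment⁻ b′∈row | ∈-boxesFrom⁻ (suc i) rest b∈rest
... | refl , _ | i<i , _ = contradiction i<i (ℕₚ.<-irrefl refl)
boxesFrom-rowConvex i (a ∷ rest) dec b∈ b′∈ j<l | inj₂ b∈rest | inj₂ b′∈rest =
  ∈-++⁺ʳ (row-segment i a) (boxesFrom-rowConvex (suc i) rest (Linked.tail dec) b∈rest b′∈rest j<l)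

boxesFrom-columnConvex : ∀ i lam → Linked _>_ lam → ColumnConvex (boxesFrom i lam)
boxesFrom-columnConvex i (a ∷ rest) dec b∈ b′∈ i<k with ∈-++⁻ (row-segment i a) b∈ | ∈-++⁻ (row-segment i a) b′∈
... | inj₁ b∈row | inj₁ b′∈row with ∈-row-segment⁻ b∈row | ∈-row-segment⁻ b′∈row
...   | refl , _ | refl , _ = contradiction i<k (ℕₚ.<-irrefl refl)
boxesFrom-columnConvex i (a ∷ rest) dec b∈ b′∈ i<k | inj₂ b∈rest | inj₁ b′∈row
  with ∈-row-segment⁻ b′∈row | ∈-boxesFrom⁻ (suc i) rest b∈rest
... | refl , _ | i<i′ , _ = contradiction i<k (ℕₚ.<-asym i<i′)
boxesFrom-columnConvex i (a ∷ rest) dec b∈ b′∈ i<k | inj₂ b∈rest | inj₂ b′∈rest =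
  ∈-++⁺ʳ (row-segment i a) (boxesFrom-columnConvex (suc i) rest (Linked.tail dec) b∈rest b′∈rest i<k)
boxesFrom-columnConvex i (a ∷ []) dec b∈ b′∈ i<k | inj₁ _ | inj₂ ()
boxesFrom-columnConvex i (a ∷ a′ ∷ rest) (_ ∷ dec) b∈ b′∈ i<k | inj₁ b∈row | inj₂ b′∈rest
  with ∈-row-segment⁻ b∈row | ∈-boxesFrom⁻ (suc i) (a′ ∷ rest) b′∈rest
... | refl , _ | i<k′ , k≤j =
  ∈-++⁺ʳ (row-segment i a) (∈-++⁺ˡ (∈-row-segment⁺ (ℕₚ.≤-trans i<k′ k≤j) (∈-boxesFrom-col< (suc i) a′ rest dec b′∈rest)))

boxesFrom-unique : ∀ i lam → Unique (boxesFrom i lam)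
boxesFrom-unique i []         = []
boxesFrom-unique i (a ∷ rest) = Uniqueₚ.++⁺
  (Uniqueₚ.applyUpTo⁺₁ _ a (λ s<t _ eq → ℕₚ.<⇒≢ s<t (ℕₚ.+-cancelˡ-≡ i _ _ (cong proj₂ eq))))
  (boxesFrom-unique (suc i) rest)
  disjoint
  where
  disjoint : ∀ {b} → ¬ (b ∈ row-segment i a × b ∈ boxesFrom (suc i) rest)
  disjoint {r , c} (b∈row , b∈rest) with ∈-row-segment⁻ b∈row | ∈-boxesFrom⁻ (suc i) rest b∈rest
  ... | refl , _ | i<i , _ = ℕₚ.<-irrefl refl i<i

length-boxesFrom : ∀ i lam → length (boxesFrom i lam) ≡ size lam
length-boxesFrom i []         = refl
length-boxesFrom i (a ∷ rest) = trans (Listₚ.length-++ (row-segment i a))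
  (cong₂ ℕ._+_ (Listₚ.length-applyUpTo _ a) (length-boxesFrom (suc i) rest))

-- Tableau conditions for fillings given as functions on boxes

right below : Box → Box
right b = (row b , suc (col b))
below b = (suc (row b) , col b)

-- unprimed: condition (4) of SSVT_P; free: no diagonal condition, as in SSVT_Q.
data DiagonalRule : Set where
  unprimed free : DiagonalRule

module _ (B : List Box) (D : Box → List ℕ) where

  WeaklyIncreasing : Set
  WeaklyIncreasing = All (λ b → (D b ≼ D (right b)) × (D b ≼ D (below b))) B

  ColumnStrict : Set
  ColumnStrict = All (λ b₁ → All (λ b₂ → b₁ ≢ b₂ → col b₁ ≡ col b₂ →
                   All (λ c → Unprimed c → c ∉ D b₂) (D b₁)) B) B

  RowStrict : Set
  RowStrict = All (λ b₁ → All (λ b₂ → b₁ ≢ b₂ → row b₁ ≡ row b₂ →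
                All (λ c → Primed c → c ∉ D b₂) (D b₁)) B) B

  DiagonalCondition : DiagonalRule → Set
  DiagonalCondition unprimed = All (λ b → row b ≡ col b → All Unprimed (D b)) B
  DiagonalCondition free     = ⊤

IsTableau : DiagonalRule → List Box → (Box → List ℕ) → Set
IsTableau δ B D = WeaklyIncreasing B D × ColumnStrict B D × RowStrict B D × DiagonalCondition B D δ

isTableau? : ∀ δ B D → Dec (IsTableau δ B D)
isTableau? δ B D =
  all? (λ b → (D b ≼? D (right b)) ×-dec (D b ≼? D (below b))) B
  ×-dec all? (λ b₁ → all? (λ b₂ → ¬? (b₁ ≟B b₂) →-dec (ℕ._≟_ (col b₁) (col b₂) →-dec
          all? (λ c → ℕ._≟_ (c % 2) 0 →-dec (c ∉? D b₂)) (D b₁))) B) B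
  ×-dec all? (λ b₁ → all? (λ b₂ → ¬? (b₁ ≟B b₂) →-dec (ℕ._≟_ (row b₁) (row b₂) →-dec
          all? (λ c → ℕ._≟_ (c % 2) 1 →-dec (c ∉? D b₂)) (D b₁))) B) B
  ×-dec diagonal? δ
  where
  diagonal? : ∀ δ → Dec (DiagonalCondition B D δ)
  diagonal? unprimed = all? (λ b → ℕ._≟_ (row b) (col b) →-dec all? (λ c → ℕ._≟_ (c % 2) 0) (D b)) B
  diagonal? free     = yes tt

SupportedOn : List Box → (Box → List ℕ) → Set
SupportedOn B D = ∀ {b} → b ∉ B → D b ≡ []

≼-⊆ : ∀ {s t s′ t′} → s ⊆ s′ → t ⊆ t′ → s′ ≼ t′ → s ≼ t
≼-⊆ s⊆s′ t⊆t′ s′≼t′ = All.tabulate (λ a∈s → All.tabulate (λ b∈t → All.lookup (All.lookup s′≼t′ (s⊆s′ a∈s)) (t⊆t′ b∈t)))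

IsTableau-⊆ : ∀ {δ B D S} → (∀ b → S b ⊆ D b) → IsTableau δ B D → IsTableau δ B S
IsTableau-⊆ {δ} {B} {D} {S} S⊆D (incr , colStrict , rowStrict , diag) =
    All.map (λ (r , d) → ≼-⊆ (S⊆D _) (S⊆D _) r , ≼-⊆ (S⊆D _) (S⊆D _) d) incr
  , All.map (λ {b₁} → All.map (λ {b₂} → strict {b₁} {b₂})) colStrict
  , All.map (λ {b₁} → All.map (λ {b₂} → strict {b₁} {b₂})) rowStrict
  , diagonal δ diag
  where
  strict : ∀ {b₁ b₂} {L : ℕ → Set} {R₁ R₂ : Set} → (R₁ → R₂ → All (λ c → L c → c ∉ D b₂) (D b₁)) →
           R₁ → R₂ → All (λ c → L c → c ∉ S b₂) (S b₁)
  strict fresh r₁ r₂ = All.tabulate (λ c∈ Lc c∈′ → All.lookup (fresh r₁ r₂) (S⊆D _ c∈) Lc (S⊆D _ c∈′))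
  diagonal : ∀ δ → DiagonalCondition B D δ → DiagonalCondition B S δ
  diagonal unprimed diag = All.map (λ unp d → All.tabulate (λ c∈ → All.lookup (unp d) (S⊆D _ c∈))) diag
  diagonal free     _    = tt

∈-support : ∀ {B D} → SupportedOn B D → ∀ {b c} → c ∈ D b → b ∈ B
∈-support {B} {D} supp {b} c∈ with b ∈? B
... | yes b∈ = b∈
... | no  b∉ = contradiction (subst (_ ∈_) (supp b∉) c∈) λ ()

DiagonalOK : DiagonalRule → Box → ℕ → Set
DiagonalOK unprimed b c = row b ≡ col b → Unprimed c
DiagonalOK free     b c = ⊤

Fits : DiagonalRule → Box → ℕ → (rightEntry belowEntry : List ℕ) → Set
Fits δ b c r d = All (c ≤_) r × All (c ≤_) d × (Primed c → c ∉ r) × (Unprimed c → c ∉ d) × DiagonalOK δ b c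

Admissible : DiagonalRule → (Box → List ℕ) → Box → ℕ → Set
Admissible δ S b c = Fits δ b c (S (right b)) (S (below b))

admissible? : ∀ δ S b c → Dec (Admissible δ S b c)
admissible? δ S b c = all? (c ℕₚ.≤?_) (S (right b)) ×-dec all? (c ℕₚ.≤?_) (S (below b))
  ×-dec (ℕ._≟_ (c % 2) 1 →-dec c ∉? S (right b)) ×-dec (ℕ._≟_ (c % 2) 0 →-dec c ∉? S (below b))
  ×-dec diagonalOK? δ
  where
  diagonalOK? : ∀ δ → Dec (DiagonalOK δ b c)
  diagonalOK? unprimed = ℕ._≟_ (row b) (col b) →-dec ℕ._≟_ (c % 2) 0
  diagonalOK? free     = yes tt

∈⇒admissible : ∀ {δ B D S} → IsTableau δ B D → SupportedOn B D → (∀ b → S b ⊆ D b) →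
               ∀ {b c} → b ∈ B → c ∈ D b → Admissible δ S b c
∈⇒admissible {δ} {B} {D} {S} (incr , colStrict , rowStrict , diag) supp S⊆D {b} {c} b∈ c∈ =
    All.tabulate (λ z∈ → All.lookup (All.lookup (proj₁ (All.lookup incr b∈)) c∈) (S⊆D _ z∈))
  , All.tabulate (λ z∈ → All.lookup (All.lookup (proj₂ (All.lookup incr b∈)) c∈) (S⊆D _ z∈))
  , (λ pc c∈r → let c∈r′ = S⊆D _ c∈r in
       All.lookup (All.lookup (All.lookup rowStrict b∈) (∈-support supp c∈r′) (right≢ ∘ cong proj₂) refl) c∈ pc c∈r′)
  , (λ uc c∈d → let c∈d′ = S⊆D _ c∈d in
       All.lookup (All.lookup (All.lookup colStrict b∈) (∈-support supp c∈d′) (below≢ ∘ cong proj₁) refl) c∈ uc c∈d′)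
  , diagonalOK δ diag
  where
  right≢ : col b ≢ suc (col b)
  right≢ = ℕₚ.1+n≢n ∘ sym
  below≢ : row b ≢ suc (row b)
  below≢ = ℕₚ.1+n≢n ∘ sym
  diagonalOK : ∀ δ → DiagonalCondition B D δ → DiagonalOK δ b c
  diagonalOK unprimed diag d = All.lookup (All.lookup diag b∈ d) c∈
  diagonalOK free     _      = tt

MinFirst : List ℕ → Set
MinFirst []      = ⊤
MinFirst (x ∷ e) = All (x <_) e

MinFirst⇒head-≤ : ∀ {y g} → MinFirst (y ∷ g) → All (y ≤_) (y ∷ g)
MinFirst⇒head-≤ y<g = ℕₚ.≤-refl ∷ All.map ℕₚ.<⇒≤ y<g

≼-∷ : ∀ {s y g} → All (_≤ y) s → MinFirst (y ∷ g) → s ≼ (y ∷ g)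
≼-∷ s≤y y<g = All.map (λ a≤y → All.map (ℕₚ.≤-trans a≤y) (MinFirst⇒head-≤ y<g)) s≤y

≼-trans : ∀ {s t u} → NonEmpty t → s ≼ t → t ≼ u → s ≼ u
≼-trans (y , g , refl) s≼t t≼u = All.map (λ a≤t → All.map (ℕₚ.≤-trans (All.head a≤t)) (All.head t≼u)) s≼t

module FromHeads {δ : DiagonalRule} {B : List Box} {D S : Box → List ℕ}
  (rowConvex : RowConvex B) (columnConvex : ColumnConvex B)
  (S≡heads : ∀ b → S b ≡ take 1 (D b))
  (minFirst : ∀ b → MinFirst (D b))
  (nonEmpty : ∀ {b} → b ∈ B → NonEmpty (D b))
  (S-tableau : IsTableau δ B S)
  (extras : ∀ {b} → b ∈ B → All (Admissible δ S b) (drop 1 (D b)))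
  where

  private
    S-increasing = proj₁ S-tableau
    S-columnStrict = proj₁ (proj₂ S-tableau)
    S-rowStrict = proj₁ (proj₂ (proj₂ S-tableau))

    extras-at : ∀ {b x e} → b ∈ B → D b ≡ x ∷ e → All (Admissible δ S b) e
    extras-at {b} b∈ Db≡ = subst (λ t → All (Admissible δ S b) (drop 1 t)) Db≡ (extras b∈)

    increasing : ∀ {b} → b ∈ B → ∀ b′ → S b ≼ S b′ → (∀ {c} → Admissible δ S b c → All (c ≤_) (S b′)) → D b ≼ D b′
    increasing {b} b∈ b′ Sb≼Sb′ adm⇒≤ with nonEmpty b∈
    ... | x , e , Db≡ = subst (_≼ D b′) (sym Db≡) (≼-entry (D b′) (S≡heads b′) (minFirst b′))
      where
      ≼-entry : ∀ t → S b′ ≡ take 1 t → MinFirst t → (x ∷ e) ≼ t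
      ≼-entry []      _     _   = All.tabulate (λ _ → [])
      ≼-entry (y ∷ g) Sb′≡y y<g =
        ≼-∷ (x≤y ∷ All.map (λ {c} adm → All.head (subst (All (c ≤_)) Sb′≡y (adm⇒≤ adm))) (extras-at b∈ Db≡)) y<g
        where
        x≤y : x ≤ y
        x≤y = All.head (All.head (subst₂ _≼_ (trans (S≡heads b) (cong (take 1) Db≡)) Sb′≡y Sb≼Sb′))

  D-increasing : WeaklyIncreasing B D
  D-increasing = All.tabulate λ {b} b∈ →
      increasing b∈ (right b) (proj₁ (All.lookup S-increasing b∈)) proj₁
    , increasing b∈ (below b) (proj₂ (All.lookup S-increasing b∈)) (proj₁ ∘ proj₂)

  -- A column (pos i = (i , j)) or a row (pos j = (r , j)) of B.
  module Line (pos : ℕ → Box) (convex : ∀ {i k} → pos i ∈ B → pos k ∈ B → i < k → pos (suc i) ∈ B)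
    (step : ∀ {i} → pos i ∈ B → D (pos i) ≼ D (pos (suc i)))
    {L : ℕ → Set}
    (S-fresh : ∀ {i} → pos i ∈ B → pos (suc i) ∈ B → All (λ c → L c → c ∉ S (pos (suc i))) (S (pos i)))
    (extra-fresh : ∀ {i c} → Admissible δ S (pos i) c → L c → c ∉ S (pos (suc i)))
    where

    between : ∀ {i k t} → pos i ∈ B → pos k ∈ B → i ≤′ t → t ≤ k → pos t ∈ B
    between pi∈ pk∈ (≤′-reflexive refl) _   = pi∈
    between pi∈ pk∈ (≤′-step i≤′t)     t<k = convex (between pi∈ pk∈ i≤′t (ℕₚ.<⇒≤ t<k)) pk∈ t<k

    ≼-along : ∀ {i k} → pos i ∈ B → pos k ∈ B → suc i ≤′ k → D (pos i) ≼ D (pos k)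
    ≼-along pi∈ pk∈ (≤′-reflexive refl) = step pi∈
    ≼-along pi∈ pk∈ (≤′-step i<′k)      = ≼-trans (nonEmpty pk′∈) (≼-along pi∈ pk′∈ i<′k) (step pk′∈)
      where pk′∈ = between pi∈ pk∈ (ℕₚ.≤′-trans (≤′-step (≤′-reflexive refl)) i<′k) (ℕₚ.n≤1+n _)

    head-≤ : ∀ {i k y g} → pos i ∈ B → pos k ∈ B → i ≤′ k → D (pos i) ≡ y ∷ g → All (y ≤_) (D (pos k))
    head-≤ {i} pi∈ pk∈ (≤′-reflexive refl) Dpi≡ =
      subst (All _) (sym Dpi≡) (MinFirst⇒head-≤ (subst MinFirst Dpi≡ (minFirst (pos i))))
    head-≤ {k = k} pi∈ pk∈ (≤′-step i≤′k) Dpi≡ = All.head (subst (_≼ D (pos k)) Dpi≡ (≼-along pi∈ pk∈ (ℕₚ.s≤′s i≤′k)))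

    -- c is squeezed to the minimum y of D (pos (suc i)), so c ∈ S (pos (suc i)); this contradicts
    -- the strictness of S if c is the minimum of D (pos i), and admissibility otherwise.
    no-repeat : ∀ {i k c} → pos i ∈ B → pos k ∈ B → i < k → L c → c ∈ D (pos i) → c ∉ D (pos k)
    no-repeat {i} {k} {c} pi∈ pk∈ i<k Lc c∈i c∈k with nonEmpty pi∈ | nonEmpty (convex pi∈ pk∈ i<k)
    ... | x , e , Dpi≡ | y , g , Dpi′≡ = clash (subst (c ∈_) Dpi≡ c∈i)
      where
      pi′∈ = convex pi∈ pk∈ i<k
      c≤y : c ≤ y
      c≤y = All.head (subst (All (c ≤_)) Dpi′≡ (All.lookup (step pi∈) c∈i))
      y≤c : y ≤ c
      y≤c = All.lookup (head-≤ pi′∈ pk∈ (ℕₚ.≤⇒≤′ i<k) Dpi′≡) c∈k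
      c∈S′ : c ∈ S (pos (suc i))
      c∈S′ = subst (c ∈_) (sym (trans (S≡heads _) (cong (take 1) Dpi′≡))) (here (ℕₚ.≤-antisym c≤y y≤c))
      clash : c ∈ x ∷ e → ⊥
      clash (here refl) = All.head (subst (All _) (trans (S≡heads _) (cong (take 1) Dpi≡)) (S-fresh pi∈ pi′∈)) Lc c∈S′
      clash (there c∈e) = extra-fresh (All.lookup (extras-at pi∈ Dpi≡) c∈e) Lc c∈S′

  module Column (j : ℕ) = Line (λ i → (i , j)) columnConvex (λ p∈ → proj₂ (All.lookup D-increasing p∈))
    (λ p∈ p′∈ → All.lookup (All.lookup S-columnStrict p∈) p′∈ (ℕₚ.1+n≢n ∘ sym ∘ cong proj₁) refl)
    (proj₁ ∘ proj₂ ∘ proj₂ ∘ proj₂)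

  module Row (r : ℕ) = Line (λ j → (r , j)) rowConvex (λ p∈ → proj₁ (All.lookup D-increasing p∈))
    (λ p∈ p′∈ → All.lookup (All.lookup S-rowStrict p∈) p′∈ (ℕₚ.1+n≢n ∘ sym ∘ cong proj₂) refl)
    (proj₁ ∘ proj₂ ∘ proj₂)

  D-columnStrict : ColumnStrict B D
  D-columnStrict = All.tabulate λ {b₁} b₁∈ → All.tabulate λ {b₂} b₂∈ b₁≢b₂ same →
    All.tabulate λ c∈ c-unprimed → fresh b₁ b₂ b₁∈ b₂∈ b₁≢b₂ same c-unprimed c∈
    where
    fresh : ∀ b₁ b₂ {c} → b₁ ∈ B → b₂ ∈ B → b₁ ≢ b₂ → col b₁ ≡ col b₂ → Unprimed c → c ∈ D b₁ → c ∉ D b₂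
    fresh (i₁ , j) (i₂ , .j) b₁∈ b₂∈ b₁≢b₂ refl c-unprimed c∈₁ c∈₂ with ℕₚ.<-cmp i₁ i₂
    ... | tri< i₁<i₂ _ _ = Column.no-repeat j b₁∈ b₂∈ i₁<i₂ c-unprimed c∈₁ c∈₂
    ... | tri≈ _ refl _  = b₁≢b₂ refl
    ... | tri> _ _ i₂<i₁ = Column.no-repeat j b₂∈ b₁∈ i₂<i₁ c-unprimed c∈₂ c∈₁

  D-rowStrict : RowStrict B D
  D-rowStrict = All.tabulate λ {b₁} b₁∈ → All.tabulate λ {b₂} b₂∈ b₁≢b₂ same →
    All.tabulate λ c∈ c-primed → fresh b₁ b₂ b₁∈ b₂∈ b₁≢b₂ same c-primed c∈
    where
    fresh : ∀ b₁ b₂ {c} → b₁ ∈ B → b₂ ∈ B → b₁ ≢ b₂ → row b₁ ≡ row b₂ → Primed c → c ∈ D b₁ → c ∉ D b₂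
    fresh (r , j₁) (.r , j₂) b₁∈ b₂∈ b₁≢b₂ refl c-primed c∈₁ c∈₂ with ℕₚ.<-cmp j₁ j₂
    ... | tri< j₁<j₂ _ _ = Row.no-repeat r b₁∈ b₂∈ j₁<j₂ c-primed c∈₁ c∈₂
    ... | tri≈ _ refl _  = b₁≢b₂ refl
    ... | tri> _ _ j₂<j₁ = Row.no-repeat r b₂∈ b₁∈ j₂<j₁ c-primed c∈₂ c∈₁

  D-diagonal : ∀ δ′ → DiagonalCondition B S δ′ → (∀ {b} → b ∈ B → All (DiagonalOK δ′ b) (drop 1 (D b))) →
               DiagonalCondition B D δ′
  D-diagonal unprimed S-diagonal extras-ok = All.tabulate λ {b} b∈ diag → on-diagonal b∈ diag (nonEmpty b∈)
    where
    on-diagonal : ∀ {b} → b ∈ B → row b ≡ col b → NonEmpty (D b) → All Unprimed (D b)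
    on-diagonal {b} b∈ diag (x , e , Db≡) = subst (All Unprimed) (sym Db≡)
      (  All.head (subst (All Unprimed) (trans (S≡heads b) (cong (take 1) Db≡)) (All.lookup S-diagonal b∈ diag))
      ∷ All.map (λ ok → ok diag) (subst (λ t → All (DiagonalOK unprimed b) (drop 1 t)) Db≡ (extras-ok b∈)))
  D-diagonal free _ _ = tt

  D-tableau : IsTableau δ B D
  D-tableau = D-increasing , D-columnStrict , D-rowStrict ,
    D-diagonal δ (proj₂ (proj₂ (proj₂ S-tableau))) (λ b∈ → All.map (proj₂ ∘ proj₂ ∘ proj₂ ∘ proj₂) (extras b∈))

-- Saturated single-valued tableaux

update : (Box → List ℕ) → Box → List ℕ → Box → List ℕ
update S b s b′ with b′ ≟B b
... | yes _ = s
... | no  _ = S b′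

update-same : ∀ S b s → update S b s b ≡ s
update-same S b s with b ≟B b
... | yes _  = refl
... | no b≢b = contradiction refl b≢b

module _ {A : Set} where

  sum-map-≤ : ∀ {f g : A → ℕ} xs → (∀ {x} → x ∈ xs → f x ≤ g x) → sum (map f xs) ≤ sum (map g xs)
  sum-map-≤ []       _   = z≤n
  sum-map-≤ (x ∷ xs) f≤g = ℕₚ.+-mono-≤ (f≤g (here refl)) (sum-map-≤ xs (f≤g ∘ there))

  sum-map-< : ∀ {f g : A → ℕ} xs → (∀ {x} → x ∈ xs → f x ≤ g x) → ∀ {y} → y ∈ xs → f y < g y →
              sum (map f xs) < sum (map g xs)
  sum-map-< (x ∷ xs) f≤g (here refl) fy<gy = ℕₚ.+-mono-<-≤ fy<gy (sum-map-≤ xs (f≤g ∘ there))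
  sum-map-< (x ∷ xs) f≤g (there y∈) fy<gy = ℕₚ.+-mono-≤-< (f≤g (here refl)) (sum-map-< xs (f≤g ∘ there) y∈ fy<gy)

  sum-map-≤-bound : ∀ {f : A → ℕ} {k} xs → (∀ {x} → x ∈ xs → f x ≤ k) → sum (map f xs) ≤ length xs ℕ.* k
  sum-map-≤-bound []       _   = z≤n
  sum-map-≤-bound (x ∷ xs) f≤k = ℕₚ.+-mono-≤ (f≤k (here refl)) (sum-map-≤-bound xs (f≤k ∘ there))

module Saturation (δ : DiagonalRule) (n : ℕ) (B : List Box) where

  private
    top = 2 ℕ.* n

  Saturated : (Box → List ℕ) → Box → ℕ → Set
  Saturated S b x = All (λ c → ¬ Admissible δ S b c) (above top x)

  saturated? : ∀ S b x → Dec (Saturated S b x)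
  saturated? S b x = all? (λ c → ¬? (admissible? δ S b c)) (above top x)

  SingleLetter : List ℕ → Set
  SingleLetter s = ∃ λ x → s ≡ x ∷ [] × x ∈ letters n

  SingleValued : (Box → List ℕ) → Set
  SingleValued S = SupportedOn B S × (∀ {b} → b ∈ B → SingleLetter (S b))

  SaturatedTableau : (Box → List ℕ) → Set
  SaturatedTableau S = IsTableau δ B S × SingleValued S × (∀ {b} → b ∈ B → All (Saturated S b) (S b))

  SaturatedTableau-cong : ∀ {S S′} → (∀ b → S b ≡ S′ b) → SaturatedTableau S → SaturatedTableau S′
  SaturatedTableau-cong {S} {S′} S≗S′ (S-tab , (supp , single) , sat) =
      IsTableau-⊆ (λ b → subst (_⊆ S b) (S≗S′ b) id) S-tab
    , ((λ b∉ → trans (sym (S≗S′ _)) (supp b∉)) , λ b∈ → subst SingleLetter (S≗S′ _) (single b∈))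
    , λ {b} b∈ → subst (All (Saturated S′ b)) (S≗S′ b) (All.map (All.map (λ {c} ¬adm adm′ →
        ¬adm (subst₂ (Fits δ b c) (sym (S≗S′ (right b))) (sym (S≗S′ (below b))) adm′))) (sat b∈))

  rank : Box → ℕ
  rank b = row b ℕ.+ col b

  rank<bound : ∀ {b} → b ∈ B → rank b < sum (map (suc ∘ rank) B)
  rank<bound = go B
    where
    go : ∀ B′ {b} → b ∈ B′ → rank b < sum (map (suc ∘ rank) B′)
    go (b ∷ B′) (here refl) = ℕₚ.m≤m+n _ _
    go (b ∷ B′) (there b∈) = ℕₚ.<-≤-trans (go B′ b∈) (ℕₚ.m≤n+m _ _)

  -- Descending induction on rank: beyond the bound both tableaux are empty.
  saturatedTableau-unique : ∀ {S S′} → SaturatedTableau S → SaturatedTableau S′ → ∀ b → S b ≡ S′ b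
  saturatedTableau-unique {S} {S′} sat sat′ b = agree bound b (ℕₚ.m≤n+m bound (rank b))
    where
    bound = sum (map (suc ∘ rank) B)
    not-below : ∀ {S S′ b x y} → SaturatedTableau S → SaturatedTableau S′ → b ∈ B →
                S (right b) ≡ S′ (right b) → S (below b) ≡ S′ (below b) →
                S b ≡ x ∷ [] → S′ b ≡ y ∷ [] → y ∈ letters n → ¬ x < y
    not-below {S} {S′} {b} {x} {y} (_ , _ , S-sat) (S′-tab , (S′-supp , _) , _) b∈ ≡right ≡below Sb≡ S′b≡ y∈ x<y =
      All.lookup (All.head (subst (All (Saturated S b)) Sb≡ (S-sat b∈))) (∈-above⁺ n x<y y∈)
        (subst₂ (Fits δ b y) (sym ≡right) (sym ≡below)
          (∈⇒admissible S′-tab S′-supp (λ _ → id) b∈ (subst (y ∈_) (sym S′b≡) (here refl))))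
    agree-at : ∀ {b} → b ∈ B → S (right b) ≡ S′ (right b) → S (below b) ≡ S′ (below b) → S b ≡ S′ b
    agree-at b∈ ≡right ≡below with proj₂ (proj₁ (proj₂ sat)) b∈ | proj₂ (proj₁ (proj₂ sat′)) b∈
    ... | x , Sb≡ , x∈ | y , S′b≡ , y∈ with ℕₚ.<-cmp x y
    ... | tri< x<y _ _  = contradiction x<y (not-below sat sat′ b∈ ≡right ≡below Sb≡ S′b≡ y∈)
    ... | tri≈ _ refl _ = trans Sb≡ (sym S′b≡)
    ... | tri> _ _ y<x  = contradiction y<x (not-below sat′ sat b∈ (sym ≡right) (sym ≡below) S′b≡ Sb≡ x∈)
    agree : ∀ d b → bound ≤ rank b ℕ.+ d → S b ≡ S′ b
    agree d b bound≤ with b ∈? B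
    ... | no b∉ = trans (proj₁ (proj₁ (proj₂ sat)) b∉) (sym (proj₁ (proj₁ (proj₂ sat′)) b∉))
    agree zero    b bound≤ | yes b∈ =
      contradiction (ℕₚ.<-≤-trans (rank<bound b∈) (subst (bound ≤_) (ℕₚ.+-identityʳ (rank b)) bound≤)) (ℕₚ.<-irrefl refl)
    agree (suc d) b bound≤ | yes b∈ = agree-at b∈
      (agree d (right b) (subst (bound ≤_)
        (sym (trans (cong (ℕ._+ d) (ℕₚ.+-suc (row b) (col b))) (sym (ℕₚ.+-suc (rank b) d)))) bound≤))
      (agree d (below b) (subst (bound ≤_) (ℕₚ.+-suc (rank b) d) bound≤))

  entrySum : (Box → List ℕ) → ℕ
  entrySum S = sum (map (sum ∘ S) B)

  entrySum-bound : ∀ {S} → SingleValued S → entrySum S ≤ length B ℕ.* top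
  entrySum-bound (_ , single) = sum-map-≤-bound B λ b∈ → let (x , Sb≡ , x∈) = single b∈ in
    subst (λ s → sum s ≤ top) (sym Sb≡) (subst (_≤ top) (sym (ℕₚ.+-identityʳ x)) (proj₂ (∈-letters⁻ n x∈)))

  Raisable : (Box → List ℕ) → Set
  Raisable S = ∃ λ b → ∃₂ λ x c → b ∈ B × S b ≡ x ∷ [] × x < c × c ∈ letters n × Admissible δ S b c

  saturated-or-raisable : ∀ {S} → SingleValued S → (∀ {b} → b ∈ B → All (Saturated S b) (S b)) ⊎ Raisable S
  saturated-or-raisable {S} (_ , single) with all? (λ b → all? (saturated? S b) (S b)) B
  ... | yes sat = inj₁ (All.lookup sat)
  ... | no ¬sat with find (¬All⇒Any¬ (λ b → all? (saturated? S b) (S b)) B ¬sat)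
  ...   | b , b∈ , ¬sat-b with single b∈
  ...     | x , Sb≡ , x∈ with find (¬All⇒Any¬ (λ c → ¬? (admissible? δ S b c)) (above top x)
                                     (¬sat-b ∘ λ sat-x → subst (All (Saturated S b)) (sym Sb≡) (sat-x ∷ [])))
  ...       | c , c∈above , ¬¬adm with ∈-above⁻ n (proj₂ (∈-letters⁻ n x∈)) c∈above
  ...         | x<c , c∈ = inj₂ (b , x , c , b∈ , Sb≡ , x<c , c∈ , decidable-stable (admissible? δ S b c) ¬¬adm)

  module _ (rowConvex : RowConvex B) (columnConvex : ColumnConvex B) where

    private
      no-extras : ∀ {S} → SingleValued S → ∀ b → drop 1 (S b) ≡ []
      no-extras {S} (supp , single) b with b ∈? B
      ... | no b∉ = cong (drop 1) (supp b∉)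
      ... | yes b∈ with single b∈
      ...   | x , Sb≡ , _ = cong (drop 1) Sb≡

      take-1-self : ∀ (s : List ℕ) → drop 1 s ≡ [] → s ≡ take 1 s
      take-1-self []          _    = refl
      take-1-self (x ∷ [])    _    = refl

      MinFirst-single : ∀ s → drop 1 s ≡ [] → MinFirst s
      MinFirst-single []       _ = _
      MinFirst-single (x ∷ []) _ = []

    raise : ∀ {S b x c} → IsTableau δ B S → SingleValued S → b ∈ B → S b ≡ x ∷ [] → x < c → c ∈ letters n →
            Admissible δ S b c → IsTableau δ B (update S b (c ∷ [])) × SingleValued (update S b (c ∷ []))
    raise {S} {b} {x} {c} S-tab S-single@(supp , single) b∈ Sb≡ x<c c∈ adm =
      IsTableau-⊆ raised⊆D D-tableau , raised-supp , raised-single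
      where
      D = update S b (x ∷ c ∷ [])
      S≡heads : ∀ b′ → S b′ ≡ take 1 (D b′)
      S≡heads b′ with b′ ≟B b
      ... | yes refl = Sb≡
      ... | no  _    = take-1-self (S b′) (no-extras S-single b′)
      minFirst : ∀ b′ → MinFirst (D b′)
      minFirst b′ with b′ ≟B b
      ... | yes _ = x<c ∷ []
      ... | no  _ = MinFirst-single (S b′) (no-extras S-single b′)
      nonEmpty : ∀ {b′} → b′ ∈ B → NonEmpty (D b′)
      nonEmpty {b′} b′∈ with b′ ≟B b
      ... | yes _ = x , c ∷ [] , refl
      ... | no  _ = let (y , Sb′≡ , _) = single b′∈ in y , [] , Sb′≡
      extras : ∀ {b′} → b′ ∈ B → All (Admissible δ S b′) (drop 1 (D b′))
      extras {b′} _ with b′ ≟B b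
      ... | yes refl = adm ∷ []
      ... | no  _    = subst (All _) (sym (no-extras S-single b′)) []
      D-tableau : IsTableau δ B D
      D-tableau = FromHeads.D-tableau rowConvex columnConvex S≡heads minFirst nonEmpty S-tab extras
      raised⊆D : ∀ b′ → update S b (c ∷ []) b′ ⊆ D b′
      raised⊆D b′ with b′ ≟B b
      ... | yes _ = λ { (here refl) → there (here refl) }
      ... | no  _ = id
      raised-supp : SupportedOn B (update S b (c ∷ []))
      raised-supp {b′} b′∉ with b′ ≟B b
      ... | yes refl = contradiction b∈ b′∉
      ... | no  _    = supp b′∉
      raised-single : ∀ {b′} → b′ ∈ B → SingleLetter (update S b (c ∷ []) b′)
      raised-single {b′} b′∈ with b′ ≟B b
      ... | yes _ = c , refl , c∈
      ... | no  _ = single b′∈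

    raise-entrySum : ∀ {S b x c} → SingleValued S → b ∈ B → S b ≡ x ∷ [] → x < c →
                    entrySum S < entrySum (update S b (c ∷ []))
    raise-entrySum {S} {b} {x} {c} (_ , single) b∈ Sb≡ x<c = sum-map-< B pointwise b∈ at-b
      where
      at-b : sum (S b) < sum (update S b (c ∷ []) b)
      at-b rewrite Sb≡ | update-same S b (c ∷ []) = ℕₚ.+-monoˡ-< 0 x<c
      pointwise : ∀ {b′} → b′ ∈ B → sum (S b′) ≤ sum (update S b (c ∷ []) b′)
      pointwise {b′} b′∈ with b′ ≟B b
      ... | yes refl = ℕₚ.<⇒≤ at-b′
        where at-b′ : sum (S b) < c ℕ.+ 0
              at-b′ rewrite Sb≡ = ℕₚ.+-monoˡ-< 0 x<c
      ... | no  _    = ℕₚ.≤-refl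

    -- Each raise increases entrySum, which never exceeds length B * top.
    saturate : ∀ fuel S → IsTableau δ B S → SingleValued S → length B ℕ.* top ≤ entrySum S ℕ.+ fuel →
               ∃ SaturatedTableau
    saturate fuel S S-tab S-single room with saturated-or-raisable S-single
    saturate fuel S S-tab S-single room | inj₁ sat = S , S-tab , S-single , sat
    saturate zero S S-tab S-single room | inj₂ (b , x , c , b∈ , Sb≡ , x<c , c∈ , adm) =
      contradiction (ℕₚ.≤-<-trans (ℕₚ.≤-trans (entrySum-bound S′-single) |B|*top≤) (raise-entrySum S-single b∈ Sb≡ x<c))
                    (ℕₚ.<-irrefl refl)
      where
      S′-single = proj₂ (raise S-tab S-single b∈ Sb≡ x<c c∈ adm)
      |B|*top≤ : length B ℕ.* top ≤ entrySum S
      |B|*top≤ = subst (length B ℕ.* top ≤_) (ℕₚ.+-identityʳ (entrySum S)) room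
    saturate (suc fuel) S S-tab S-single room | inj₂ (b , x , c , b∈ , Sb≡ , x<c , c∈ , adm) =
      saturate fuel S′ (proj₁ raised) (proj₂ raised) room′
      where
      S′ = update S b (c ∷ [])
      raised = raise S-tab S-single b∈ Sb≡ x<c c∈ adm
      room′ : length B ℕ.* top ≤ entrySum S′ ℕ.+ fuel
      room′ = ℕₚ.≤-trans room (subst (_≤ entrySum S′ ℕ.+ fuel) (sym (ℕₚ.+-suc (entrySum S) fuel))
                                     (ℕₚ.+-monoˡ-≤ fuel (raise-entrySum S-single b∈ Sb≡ x<c)))

    saturatedTableau-exists : ∀ {S} → IsTableau δ B S → SingleValued S → ∃ SaturatedTableau
    saturatedTableau-exists {S} S-tab S-single = saturate (length B ℕ.* top) S S-tab S-single (ℕₚ.m≤n+m _ (entrySum S))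

-- The signed count of set-valued tableaux

card-zipWith-∷ : ∀ X E → length X ≡ length E → card (zipWith _∷_ X E) ≡ length X ℕ.+ sum (map length E)
card-zipWith-∷ []      []      _  = refl
card-zipWith-∷ (x ∷ X) (e ∷ E) eq = cong suc (trans (cong (length e ℕ.+_) (card-zipWith-∷ X E (ℕₚ.suc-injective eq)))
                                                    (swap (length e) (length X) _))
  where
  swap : ∀ a b c → a ℕ.+ (b ℕ.+ c) ≡ b ℕ.+ (a ℕ.+ c)
  swap a b c = trans (sym (ℕₚ.+-assoc a b c)) (trans (cong (ℕ._+ c) (ℕₚ.+-comm a b)) (ℕₚ.+-assoc b a c))

-1^sum-lengths : ∀ {L A : Set} (ls : List L) (E : List (List A)) → length ls ≡ length E →
                 -1ℤ ^ sum (map length E) ≡ ∏ (zipWith (λ _ e → -1ℤ ^ length e) ls E)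
-1^sum-lengths []       []      _  = refl
-1^sum-lengths (_ ∷ ls) (e ∷ E) eq =
  trans (ℤₚ.^-distribˡ-+-* -1ℤ (length e) _) (cong (-1ℤ ^ length e *_) (-1^sum-lengths ls E (ℕₚ.suc-injective eq)))

module SignedCount (δ : DiagonalRule) (lam : List ℕ) (decreasing : Linked _>_ lam) (n : ℕ) where

  private
    B = SYD lam
    m = length B
    L = letters n
    top = 2 ℕ.* n
    rowConvex = boxesFrom-rowConvex 1 lam decreasing
    columnConvex = boxesFrom-columnConvex 1 lam decreasing

  open Saturation δ n B

  Word : List ℕ → Set
  Word X = length X ≡ m × All (_∈ L) X

  words : List (List ℕ)
  words = sequence (replicate m L)

  -- A filling in fillings n m is zipWith _∷_ X E, where the word X lists the minima of its entries
  -- and E ∈ extensions X the remaining letters.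
  extensions : List ℕ → List (List (List ℕ))
  extensions X = sequence (map (subsets ∘ above top) X)

  ∈-extensions⁻ : ∀ {X E} → E ∈ extensions X → Pointwise (λ e x → e ⊆ above top x) E X
  ∈-extensions⁻ E∈ = Pointwise.map (λ {_} {x} → ∈-subsets⁻ (above top x)) (Pointwise-mapʳ⁻ (∈-sequence⁻ _ E∈))

  singletons : List ℕ → Filling
  singletons = map (_∷ [])

  singleTableau : List ℕ → Box → List ℕ
  singleTableau X = at B (singletons X)

  extraWeight : (Box → List ℕ) → Box → List ℕ → ℤ
  extraWeight S b e = 𝟙 (all? (admissible? δ S b) e) * -1ℤ ^ length e

  SaturatedWord : List ℕ → Set
  SaturatedWord X = IsTableau δ B (singleTableau X) × Pointwise (Saturated (singleTableau X)) B X

  saturatedWord? : ∀ X → Dec (SaturatedWord X)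
  saturatedWord? X = isTableau? δ B (singleTableau X) ×-dec Pointwise.decidable (saturated? (singleTableau X)) B X

  private
    take-1-⊆ : ∀ (s : List ℕ) → take 1 s ⊆ s
    take-1-⊆ (x ∷ _) (here refl) = here refl

    drop-1-⊆ : ∀ (s : List ℕ) → drop 1 s ⊆ s
    drop-1-⊆ (x ∷ _) = there

    map-take-1-zipWith-∷ : ∀ X (E : List (List ℕ)) → length X ≡ length E → map (take 1) (zipWith _∷_ X E) ≡ singletons X
    map-take-1-zipWith-∷ []      []      _  = refl
    map-take-1-zipWith-∷ (x ∷ X) (e ∷ E) eq = cong ((x ∷ []) ∷_) (map-take-1-zipWith-∷ X E (ℕₚ.suc-injective eq))

  module Extension (X : List ℕ) (E : List (List ℕ)) (X-word : Word X)
                   (E-above : Pointwise (λ e x → e ⊆ above top x) E X) where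

    private
      T : Filling
      T = zipWith _∷_ X E
      D S : Box → List ℕ
      D = at B T
      S = singleTableau X
      |X|≡|E| : length X ≡ length E
      |X|≡|E| = sym (Pointwise.Pointwise-length E-above)
      |B|≡|E| : length B ≡ length E
      |B|≡|E| = trans (sym (proj₁ X-word)) |X|≡|E|

      entries : All (λ t → NonEmpty t × MinFirst t) T
      entries = go X E E-above
        where
        go : ∀ (X : List ℕ) E → Pointwise (λ e x → e ⊆ above top x) E X →
             All (λ t → NonEmpty t × MinFirst t) (zipWith _∷_ X E)
        go []      []      []          = []
        go (x ∷ X) (e ∷ E) (e⊆ ∷ E⊆) = ((x , e , refl) , All.tabulate (proj₁ ∘ ∈-range⁻ ∘ e⊆)) ∷ go X E E⊆

      S≡heads : ∀ b → S b ≡ take 1 (D b)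
      S≡heads b = trans (cong (λ Y → at B Y b) (sym (map-take-1-zipWith-∷ X E |X|≡|E|))) (at-map (take 1) refl B T b)

      |T|≡m : length T ≡ m
      |T|≡m = trans (Listₚ.length-zipWith _∷_ X E)
                (trans (cong (ℕ._⊓ length E) |X|≡|E|) (trans (ℕₚ.⊓-idem _) (trans (sym |X|≡|E|) (proj₁ X-word))))

      Extras : Set
      Extras = Pointwise (λ b e → All (Admissible δ S b) e) B E

      extras? : Dec Extras
      extras? = Pointwise.decidable (λ b → all? (admissible? δ S b)) B E

    tableau⇒ : IsTableau δ B D → IsTableau δ B S × Extras
    tableau⇒ D-tab = IsTableau-⊆ S⊆D D-tab , Pointwise-zipWith-∷⁻ |X|≡|E| (Pointwise-at (boxesFrom-unique 1 lam) |T|≡m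
        (λ b∈ → All.tabulate (λ c∈ → ∈⇒admissible D-tab (at-∉ B T) S⊆D b∈ (drop-1-⊆ (D _) c∈))))
      where
      S⊆D : ∀ b → S b ⊆ D b
      S⊆D b = subst (_⊆ D b) (sym (S≡heads b)) (take-1-⊆ (D b))

    tableau⇐ : IsTableau δ B S × Extras → IsTableau δ B D
    tableau⇐ (S-tab , extras) = FromHeads.D-tableau rowConvex columnConvex S≡heads
      (at-All tt (All.map proj₂ entries) B)
      (at-Pointwise (All⇒Pointwise (sym |T|≡m) (All.map proj₁ entries)))
      S-tab (at-Pointwise (Pointwise-zipWith-∷⁺ |X|≡|E| extras))

    summand-factorises : 𝟙 (isTableau? δ B D) * -1ℤ ^ (card T ∸ m) ≡ 𝟙 (isTableau? δ B S) * ∏ (zipWith (extraWeight S) B E)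
    summand-factorises = begin
        𝟙 (isTableau? δ B D) * -1ℤ ^ (card T ∸ m)
      ≡⟨ cong₂ _*_ (𝟙-⇔ (isTableau? δ B D) (S-tab? ×-dec extras?) tableau⇒ tableau⇐) sign ⟩
        𝟙 (S-tab? ×-dec extras?) * ∏ (zipWith sgn B E)
      ≡⟨ cong (_* ∏ (zipWith sgn B E)) (trans (𝟙-× S-tab? extras?) (cong (𝟙 S-tab? *_) (𝟙-Pointwise _ B E |B|≡|E|))) ⟩
        𝟙 S-tab? * ∏ (zipWith adm B E) * ∏ (zipWith sgn B E)
      ≡⟨ ℤₚ.*-assoc (𝟙 S-tab?) _ _ ⟩
        𝟙 S-tab? * (∏ (zipWith adm B E) * ∏ (zipWith sgn B E))
      ≡⟨ cong (𝟙 S-tab? *_) (∏-zipWith-* adm sgn B E) ⟩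
        𝟙 S-tab? * ∏ (zipWith (extraWeight S) B E)
      ∎
      where
      open ≡-Reasoning
      S-tab? = isTableau? δ B S
      adm sgn : Box → List ℕ → ℤ
      adm b e = 𝟙 (all? (admissible? δ S b) e)
      sgn _ e = -1ℤ ^ length e
      sign : -1ℤ ^ (card T ∸ m) ≡ ∏ (zipWith sgn B E)
      sign = trans (cong (λ k → -1ℤ ^ (k ∸ m))
                         (trans (card-zipWith-∷ X E |X|≡|E|) (cong (ℕ._+ sum (map length E)) (proj₁ X-word))))
                   (trans (cong (-1ℤ ^_) (ℕₚ.m+n∸m≡n m _)) (-1^sum-lengths B E |B|≡|E|))

  ∑-extensions : ∀ X → Word X →
    ∑ (extensions X) (λ E → 𝟙 (isTableau? δ B (at B (zipWith _∷_ X E))) * -1ℤ ^ (card (zipWith _∷_ X E) ∸ m)) ≡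
    𝟙 (saturatedWord? X)
  ∑-extensions X X-word = begin
      ∑ (extensions X) (λ E → 𝟙 (isTableau? δ B (at B (zipWith _∷_ X E))) * -1ℤ ^ (card (zipWith _∷_ X E) ∸ m))
    ≡⟨ ∑-cong (extensions X) (λ {E} E∈ → Extension.summand-factorises X E X-word (∈-extensions⁻ E∈)) ⟩
      ∑ (extensions X) (λ E → 𝟙 S-tab? * ∏ (zipWith (extraWeight S) B E))
    ≡⟨ sym (*-distribˡ-∑ (𝟙 S-tab?) (extensions X) _) ⟩
      𝟙 S-tab? * ∑ (extensions X) (λ E → ∏ (zipWith (extraWeight S) B E))
    ≡⟨ cong (𝟙 S-tab? *_) (∑-sequence-∏ (extraWeight S) B (map U X) (trans |B|≡|X| (sym (Listₚ.length-map U X)))) ⟩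
      𝟙 S-tab? * ∏ (zipWith ∑-extraWeight B (map U X))
    ≡⟨ cong (λ B′ → 𝟙 S-tab? * ∏ (zipWith ∑-extraWeight B′ (map U X))) (sym (Listₚ.map-id B)) ⟩
      𝟙 S-tab? * ∏ (zipWith ∑-extraWeight (map id B) (map U X))
    ≡⟨ cong (λ p → 𝟙 S-tab? * ∏ p) (Listₚ.zipWith-map ∑-extraWeight id U B X) ⟩
      𝟙 S-tab? * ∏ (zipWith (λ b x → ∑ (U x) (extraWeight S b)) B X)
    ≡⟨ cong (λ p → 𝟙 S-tab? * ∏ p)
            (Listₚ.zipWith-cong (λ b x → ∑-subsets-alternating (admissible? δ S b) (above top x)) B X) ⟩
      𝟙 S-tab? * ∏ (zipWith (λ b x → 𝟙 (saturated? S b x)) B X)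
    ≡⟨ cong (𝟙 S-tab? *_) (sym (𝟙-Pointwise (saturated? S) B X |B|≡|X|)) ⟩
      𝟙 S-tab? * 𝟙 (Pointwise.decidable (saturated? S) B X)
    ≡⟨ sym (𝟙-× S-tab? _) ⟩
      𝟙 (saturatedWord? X)
    ∎
    where
    open ≡-Reasoning
    S = singleTableau X
    S-tab? = isTableau? δ B S
    U = subsets ∘ above top
    |B|≡|X| = sym (proj₁ X-word)
    ∑-extraWeight : Box → List (List ℕ) → ℤ
    ∑-extraWeight b es = ∑ es (extraWeight S b)

  private
    Pointwise-singletons⁺ : ∀ {R : Box → ℕ → Set} {B′ X} → Pointwise R B′ X →
                            Pointwise (λ b s → All (R b) s) B′ (singletons X)
    Pointwise-singletons⁺ []       = []
    Pointwise-singletons⁺ (r ∷ rs) = (r ∷ []) ∷ Pointwise-singletons⁺ rs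

    Pointwise-singletons⁻ : ∀ {R : Box → ℕ → Set} {B′ X} → Pointwise (λ b s → All (R b) s) B′ (singletons X) →
                            Pointwise R B′ X
    Pointwise-singletons⁻ {X = []}    []              = []
    Pointwise-singletons⁻ {X = _ ∷ _} ((r ∷ []) ∷ rs) = r ∷ Pointwise-singletons⁻ rs

    |singletons|≡m : ∀ {X} → Word X → length (singletons X) ≡ m
    |singletons|≡m {X} (|X| , _) = trans (Listₚ.length-map _ X) |X|

  singleTableau-singleValued : ∀ {X} → Word X → SingleValued (singleTableau X)
  singleTableau-singleValued {X} X-word@(_ , X∈) = at-∉ B (singletons X) , at-Pointwise
    (All⇒Pointwise (sym (|singletons|≡m X-word)) (All-map⁺ {P = SingleLetter} (All.map (λ {x} x∈ → x , refl , x∈) X∈)))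

  saturatedWord⇒saturatedTableau : ∀ {X} → Word X → SaturatedWord X → SaturatedTableau (singleTableau X)
  saturatedWord⇒saturatedTableau X-word (S-tab , sat) =
    S-tab , singleTableau-singleValued X-word , at-Pointwise (Pointwise-singletons⁺ sat)

  saturatedTableau⇒saturatedWord : ∀ {X} → Word X → SaturatedTableau (singleTableau X) → SaturatedWord X
  saturatedTableau⇒saturatedWord X-word (S-tab , _ , sat) =
    S-tab , Pointwise-singletons⁻ (Pointwise-at (boxesFrom-unique 1 lam) (|singletons|≡m X-word) sat)

  saturatedWord-unique : ∀ {X Y} → Word X → SaturatedWord X → Word Y → SaturatedWord Y → X ≡ Y
  saturatedWord-unique {X} {Y} X-word X-sat Y-word Y-sat = Listₚ.map-injective Listₚ.∷-injectiveˡ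
    (at-injective (singletons X) (singletons Y) (boxesFrom-unique 1 lam) (|singletons|≡m X-word) (|singletons|≡m Y-word)
      (λ {b} _ → saturatedTableau-unique (saturatedWord⇒saturatedTableau X-word X-sat)
                                         (saturatedWord⇒saturatedTableau Y-word Y-sat) b))

  firstEntries : Filling → Box → List ℕ
  firstEntries T b = take 1 (at B T b)

  firstEntries-tableau : ∀ {T} → T ∈ fillings n m → IsTableau δ B (at B T) →
                         IsTableau δ B (firstEntries T) × SingleValued (firstEntries T)
  firstEntries-tableau {T} T∈ T-tab =
      IsTableau-⊆ (λ b → take-1-⊆ (at B T b)) T-tab
    , (λ b∉ → cong (take 1) (at-∉ B T b∉)) , λ b∈ → first-letter (at-Pointwise entries b∈)
    where
    T-shape = ∈-sequence-replicate⁻ m (subst (T ∈_) (fillings≡sequence n m) T∈)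
    entries = All⇒Pointwise (sym (proj₁ T-shape)) (All.map (∈-nonemptySubsets⁻ L) (proj₂ T-shape))
    first-letter : ∀ {t} → NonEmpty t × t ⊆ L → SingleLetter (take 1 t)
    first-letter ((x , e , refl) , t⊆) = x , refl , t⊆ (here refl)

  saturatedTableau⇒word : ∀ {S} → SaturatedTableau S → ∃ λ X → Word X × SaturatedWord X
  saturatedTableau⇒word {S} sat@(_ , (supp , single) , _) =
    X , X-word , saturatedTableau⇒saturatedWord X-word (SaturatedTableau-cong S≗ sat)
    where
    -- The default 0 is never used: S is single-valued on B.
    entry : Box → ℕ
    entry b = fromMaybe 0 (head (S b))
    X = map entry B
    X-word : Word X
    X-word = Listₚ.length-map entry B , All-map⁺ (All.tabulate λ b∈ →
      let (x , Sb≡ , x∈) = single b∈ in subst (_∈ L) (sym (cong (fromMaybe 0 ∘ head) Sb≡)) x∈)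
    S≗ : ∀ b → S b ≡ singleTableau X b
    S≗ b with b ∈? B
    ... | no  b∉ = trans (supp b∉) (sym (at-∉ B (singletons X) b∉))
    ... | yes b∈ with single b∈
    ...   | x , Sb≡ , _ = sym (begin
              at B (singletons (map entry B)) b   ≡⟨ cong (λ Y → at B Y b) (sym (Listₚ.map-∘ B)) ⟩
              at B (map ((_∷ []) ∘ entry) B) b    ≡⟨ at-map-self ((_∷ []) ∘ entry) B b∈ ⟩
              entry b ∷ []                        ≡⟨ cong (λ s → fromMaybe 0 (head s) ∷ []) Sb≡ ⟩
              x ∷ []                              ≡⟨ sym Sb≡ ⟩
              S b                                 ∎)
      where open ≡-Reasoning

  saturatedWord-exists : ∀ {T} → T ∈ fillings n m → IsTableau δ B (at B T) → ∃ λ X → Word X × SaturatedWord X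
  saturatedWord-exists T∈ T-tab =
    let (S₀-tab , S₀-single) = firstEntries-tableau T∈ T-tab
        (S , sat) = saturatedTableau-exists rowConvex columnConvex S₀-tab S₀-single
    in saturatedTableau⇒word sat

  ∑-saturatedWords : ∀ {X*} → Word X* → SaturatedWord X* → ∑ words (𝟙 ∘ saturatedWord?) ≡ 1ℤ
  ∑-saturatedWords {X*} X*-word@(|X*| , X*∈) X*-sat = begin
      ∑ words (𝟙 ∘ saturatedWord?)
    ≡⟨ ∑-cong words (λ {X} X∈ → 𝟙-⇔ (saturatedWord? X) (Pointwise.decidable ℕ._≟_ X* X)
         (λ X-sat → Pointwise.≡⇒Pointwise-≡ (saturatedWord-unique X*-word X*-sat (∈-words⁻ X∈) X-sat))
         (λ X*≡X → subst SaturatedWord (Pointwise.Pointwise-≡⇒≡ X*≡X) X*-sat)) ⟩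
      ∑ words (λ X → 𝟙 (Pointwise.decidable ℕ._≟_ X* X))
    ≡⟨ ∑-cong words (λ X∈ → 𝟙-Pointwise ℕ._≟_ X* _ (trans |X*| (sym (proj₁ (∈-words⁻ X∈))))) ⟩
      ∑ words (λ X → ∏ (zipWith (λ x* x → 𝟙 (x* ℕ.≟ x)) X* X))
    ≡⟨ ∑-sequence-∏ (λ x* x → 𝟙 (x* ℕ.≟ x)) X* (replicate m L) (trans |X*| (sym (Listₚ.length-replicate m))) ⟩
      ∏ (zipWith (λ x* xs → ∑ xs (λ x → 𝟙 (x* ℕ.≟ x))) X* (replicate m L))
    ≡⟨ ∏-ones X* m X*∈ |X*| ⟩
      1ℤ
    ∎
    where
    open ≡-Reasoning
    ∈-words⁻ = ∈-sequence-replicate⁻ m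
    ∏-ones : ∀ X k → All (_∈ L) X → length X ≡ k → ∏ (zipWith (λ x* xs → ∑ xs (λ x → 𝟙 (x* ℕ.≟ x))) X (replicate k L)) ≡ 1ℤ
    ∏-ones []       zero    []         _  = refl
    ∏-ones (x* ∷ X) (suc k) (x*∈ ∷ X∈) eq = cong₂ _*_ (∑-letters-𝟙 n x*∈) (∏-ones X k X∈ (ℕₚ.suc-injective eq))

  signed-count : ∀ {T} → T ∈ fillings n m → IsTableau δ B (at B T) →
    ∑ (fillings n m) (λ T → 𝟙 (isTableau? δ B (at B T)) * -1ℤ ^ (card T ∸ m)) ≡ 1ℤ
  signed-count T∈ T-tab with saturatedWord-exists T∈ T-tab
  ... | X* , X*-word , X*-sat = begin
      ∑ (fillings n m) summand
    ≡⟨ cong (λ Ts → ∑ Ts summand) (fillings≡sequence n m) ⟩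
      ∑ (sequence (replicate m (nonemptySubsets L))) summand
    ≡⟨ ∑-sequence-split (nonemptySubsets L) L (subsets ∘ above top) split m summand ⟩
      ∑ words (λ X → ∑ (extensions X) (λ E → summand (zipWith _∷_ X E)))
    ≡⟨ ∑-cong words (λ {X} X∈ → ∑-extensions X (∈-sequence-replicate⁻ m X∈)) ⟩
      ∑ words (𝟙 ∘ saturatedWord?)
    ≡⟨ ∑-saturatedWords X*-word X*-sat ⟩
      1ℤ
    ∎
    where
    open ≡-Reasoning
    summand : Filling → ℤ
    summand T = 𝟙 (isTableau? δ B (at B T)) * -1ℤ ^ (card T ∸ m)
    split : ∀ f → ∑ (nonemptySubsets L) f ≡ ∑ L (λ x → ∑ (subsets (above top x)) (λ e → f (x ∷ e)))
    split f rewrite letters≡range n = ∑-nonemptySubsets-range top 1 top refl f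

length≤card : ∀ T → All NonEmpty T → length T ≤ card T
length≤card []      []                   = z≤n
length≤card (s ∷ T) ((x , e , refl) ∷ ne) = s≤s (ℕₚ.≤-trans (length≤card T ne) (ℕₚ.m≤n+m _ (length e)))

≢[]⇒∃∈ : ∀ {A : Set} {xs : List A} → xs ≢ [] → ∃ λ x → x ∈ xs
≢[]⇒∃∈ {xs = []}    xs≢[] = contradiction refl xs≢[]
≢[]⇒∃∈ {xs = x ∷ _} _     = x , here refl

module _ (lam : List ℕ) (decreasing : Linked _>_ lam) (n : ℕ) (δ : DiagonalRule)
         {V : Filling → Set} (V? : Decidable V) (V⇔ : ∀ {T} → V T ⇔ IsTableau δ (SYD lam) (at (SYD lam) T)) where

  private
    B = SYD lam
    m = length B

  evalG-β≈β^size : filter V? (fillings n m) ≢ [] →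
                   evalG lam n (filter V? (fillings n m)) (λ _ → βL) -βinv ≈L (βL ^L size lam)
  evalG-β≈β^size nonempty e with ≢[]⇒∃∈ nonempty
  ... | T₀ , T₀∈ = begin
      coeff (evalG lam n Ts (λ _ → βL) -βinv) e
    ≡⟨ coeff-evalG-β lam n Ts (All.tabulate (λ T∈ → well-formed (proj₁ (∈-filter⁻ V? {xs = fillings n m} T∈)))) e ⟩
      ∑ Ts (λ T → -1ℤ ^ (card T ∸ size lam)) * c
    ≡⟨ cong (_* c) (∑-filter V? (fillings n m) _) ⟩
      ∑ (fillings n m) (λ T → 𝟙 (V? T) * -1ℤ ^ (card T ∸ size lam)) * c
    ≡⟨ cong (_* c) (∑-cong (fillings n m) (λ {T} _ →
         cong₂ _*_ (𝟙-⇔ (V? T) (isTableau? δ B (at B T)) (Equivalence.to V⇔) (Equivalence.from V⇔))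
                   (cong (λ k → -1ℤ ^ (card T ∸ k)) (sym (length-boxesFrom 1 lam))))) ⟩
      ∑ (fillings n m) (λ T → 𝟙 (isTableau? δ B (at B T)) * -1ℤ ^ (card T ∸ m)) * c
    ≡⟨ cong (_* c) (SignedCount.signed-count δ lam decreasing n T₀∈ᶠ (Equivalence.to V⇔ T₀-valid)) ⟩
      1ℤ * c
    ≡⟨ ℤₚ.*-identityˡ c ⟩
      c
    ∎
    where
    open ≡-Reasoning
    Ts = filter V? (fillings n m)
    c = coeff (βL ^L size lam) e
    T₀∈ᶠ : T₀ ∈ fillings n m
    T₀∈ᶠ = proj₁ (∈-filter⁻ V? {xs = fillings n m} T₀∈)
    T₀-valid : V T₀
    T₀-valid = proj₂ (∈-filter⁻ V? {xs = fillings n m} T₀∈)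
    well-formed : ∀ {T} → T ∈ fillings n m → All (_∈ letters n) (concat T) × size lam ≤ card T
    well-formed {T} T∈ with ∈-sequence-replicate⁻ m (subst (T ∈_) (fillings≡sequence n m) T∈)
    ... | |T| , T⊆ = concat⁺ (All.map (λ s∈ → All.tabulate (proj₂ (∈-nonemptySubsets⁻ (letters n) s∈))) T⊆)
                   , subst (_≤ card T) (trans |T| (length-boxesFrom 1 lam))
                           (length≤card T (All.map (proj₁ ∘ ∈-nonemptySubsets⁻ (letters n)) T⊆))

theorem3p1 : (lam : List ℕ) → StrictPartition lam → (n : ℕ) → 1 ≤ n →
    SSVT-P lam n ≢ [] → SSVT-Q lam n ≢ [] →
    (GP lam n (λ _ → βL) -βinv ≈L (βL ^L size lam)) ×
    (GQ lam n (λ _ → βL) -βinv ≈L (βL ^L size lam))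
theorem3p1 lam (decreasing , _) n _ P-nonempty Q-nonempty =
    evalG-β≈β^size lam decreasing n unprimed (isSSVT-P? lam)
      (mk⇔ (λ ((c₁ , c₂ , c₃) , c₄) → c₁ , c₂ , c₃ , c₄) (λ (c₁ , c₂ , c₃ , c₄) → (c₁ , c₂ , c₃) , c₄)) P-nonempty
  , evalG-β≈β^size lam decreasing n free (isSSVT-Q? lam)
      (mk⇔ (λ (c₁ , c₂ , c₃) → c₁ , c₂ , c₃ , tt) (λ (c₁ , c₂ , c₃ , _) → c₁ , c₂ , c₃)) Q-nonempty
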